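{- Let $p\equiv 1\pmod 6$ be a prime, $a\in\mathbb{F}_p^*$, and let $E$ be the elliptic curve $y^{2}=x^{3}+a^{3}$ over $\mathbb{F}_p$ with $N_{p,a}=|E(\mathbb{F}_p)|$. If $N_{p,a}\equiv 0\pmod 6$, then the number of points of order $3$ in $E(\mathbb{F}_p)$ is either $2$ or $8$.
   Context: $E(\mathbb{F}_p)$ is the group of $\mathbb{F}_p$-rational points of $E$, including the point at infinity, under the usual addition law. -}

module Defs where

open import Data.Nat using (ℕ; zero; suc; _+_; _*_; _∸_; _^_; _≡ᵇ_; NonZero)
open import Data.Nat.DivMod using (_%_)
open import Data.Bool using (Bool; true; false; if_then_else_; _∧_)
open import Data.Maybe using (Maybe; just; nothing)
open import Data.Product using (_×_; _,_)
open import Data.List using (List; length; filterᵇ; upTo; cartesianProduct)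

-- Arithmetic in 𝔽_p, with elements represented by their residues in {0,…,p-1}.
module Fp (p : ℕ) .{{_ : NonZero p}} where

  _⊕_ : ℕ → ℕ → ℕ
  x ⊕ y = (x + y) % p

  _⊗_ : ℕ → ℕ → ℕ
  x ⊗ y = (x * y) % p

  ⊝_ : ℕ → ℕ
  ⊝ x = (p ∸ (x % p)) % p

  _⊖_ : ℕ → ℕ → ℕ
  x ⊖ y = x ⊕ (⊝ y)

  -- multiplicative inverse in 𝔽_p (p prime) via Fermat: x⁻¹ = x^(p-2)
  inv : ℕ → ℕ
  inv x = (x ^ (p ∸ 2)) % p

  _==_ : ℕ → ℕ → Bool
  x == y = (x % p) ≡ᵇ (y % p)

  -- Points of E : y² = x³ + A over 𝔽_p; nothing = point at infinity O.
  Pt : Set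
  Pt = Maybe (ℕ × ℕ)

  addPt : Pt → Pt → Pt
  addPt nothing Q = Q
  addPt P nothing = P
  addPt (just (x₁ , y₁)) (just (x₂ , y₂)) =
    if x₁ == x₂
    then (if (y₁ ⊕ y₂) == 0
          then nothing
          else third ((3 ⊗ (x₁ ⊗ x₁)) ⊗ inv (2 ⊗ y₁)))
    else third ((y₂ ⊖ y₁) ⊗ inv (x₂ ⊖ x₁))
    where
    third : ℕ → Pt
    third λ' = let x₃ = ((λ' ⊗ λ') ⊖ x₁) ⊖ x₂
               in just (x₃ , (λ' ⊗ (x₁ ⊖ x₃)) ⊖ y₁)

  affinePts : ℕ → List (ℕ × ℕ)
  affinePts A = filterᵇ (λ { (x , y) → (y ⊗ y) == ((x ⊗ (x ⊗ x)) ⊕ A) })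
                        (cartesianProduct (upTo p) (upTo p))

  card : ℕ → ℕ
  card A = suc (length (affinePts A))

  -- P has order exactly 3: P ≠ O (automatic for affine points) and 3P = O
  isOrder3 : (ℕ × ℕ) → Bool
  isOrder3 P with addPt (addPt (just P) (just P)) (just P)
  ... | nothing = true
  ... | just _  = false

  numOrder3 : ℕ → ℕ
  numOrder3 A = length (filterᵇ isOrder3 (affinePts A))

-- A point P = (x, y) has order 3 iff 2P = −P, i.e. iff the tangent at P meets the curve again
-- at a point with the same x-coordinate; with slope λ = 3x²/2y this is λ² = 3x, and on the curve
-- it becomes 3x(x³ + 4b) = 0.  So the points of order 3 are (0, ±√b) and (x, ±√(−3b)) for the
-- cube roots x of −4b.  As 3 ∣ p − 1 there is a primitive cube root of unity ω: it makes
-- −3 = (2ω + 1)² a square and −4b have either no or three cube roots, so the count is 2 or 8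
-- whenever b is a square.  Finally the points with x ≠ 0 come in triples (x, y), (ωx, y),
-- (ω²x, y), so |E(𝔽_p)| ≡ 1 + #{y : y² = b} (mod 3), and 3 ∣ |E(𝔽_p)| forces b to be a square.

module Submission where

open import Defs
open import Data.Nat using (ℕ; NonZero)
open import Data.Nat.Primality using (Prime)

module Counting where

  open import Data.Bool using (Bool; true; false; T; if_then_else_; _∧_; _∨_)
  open import Data.Empty using (⊥-elim)
  open import Data.List using (List; []; _∷_; _++_; map; length; filterᵇ; cartesianProduct)
  open import Data.List.Membership.Propositional using (_∈_)
  open import Data.List.Relation.Unary.Any using (here; there)
  open import Data.List.Relation.Unary.AllPairs using (_∷_)
  open import Data.List.Relation.Unary.Unique.Propositional using (Unique)
  import Data.List.Relation.Unary.All as All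
  open import Data.Nat using (ℕ; suc; _+_; _*_)
  open import Data.Nat.Divisibility using (_∣_; _∣0; ∣m∣n⇒∣m+n)
  import Data.Nat.Properties as ℕ
  open import Data.Nat.Tactic.RingSolver using (solve-∀)
  open import Data.Product using (_×_; _,_; ∃; proj₁; proj₂)
  open import Data.Sum using (_⊎_; inj₁; inj₂)
  open import Data.Unit using (tt)
  open import Function using (_∘_; _⇔_; Equivalence)
  open import Relation.Nullary using (¬_)
  open import Relation.Binary.PropositionalEquality using (_≡_; refl; sym; trans; cong; cong₂; subst; module ≡-Reasoning)

  private variable
    A B : Set

  ∑ : List A → (A → ℕ) → ℕ
  ∑ []       g = 0
  ∑ (x ∷ xs) g = g x + ∑ xs g

  syntax ∑ xs (λ x → e) = ∑[ x ∈ xs ] e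

  ∑-cong : ∀ {g h : A → ℕ} xs → (∀ {x} → x ∈ xs → g x ≡ h x) → ∑ xs g ≡ ∑ xs h
  ∑-cong []       eq = refl
  ∑-cong (x ∷ xs) eq = cong₂ _+_ (eq (here refl)) (∑-cong xs (eq ∘ there))

  ∑-+ : ∀ (g h : A → ℕ) xs → ∑[ x ∈ xs ] (g x + h x) ≡ ∑ xs g + ∑ xs h
  ∑-+ g h []       = refl
  ∑-+ g h (x ∷ xs) = trans (cong (g x + h x +_) (∑-+ g h xs)) (shuffle (g x) (h x) (∑ xs g) (∑ xs h))
    where
    shuffle : ∀ a b c d → a + b + (c + d) ≡ a + c + (b + d)
    shuffle = solve-∀

  ∑-zero : ∀ (xs : List A) → ∑[ x ∈ xs ] 0 ≡ 0
  ∑-zero []       = refl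
  ∑-zero (x ∷ xs) = ∑-zero xs

  ∑-*ˡ : ∀ n (g : A → ℕ) xs → ∑[ x ∈ xs ] (n * g x) ≡ n * ∑ xs g
  ∑-*ˡ n g []       = sym (ℕ.*-zeroʳ n)
  ∑-*ˡ n g (x ∷ xs) = trans (cong (n * g x +_) (∑-*ˡ n g xs)) (sym (ℕ.*-distribˡ-+ n (g x) (∑ xs g)))

  ∑-*ʳ : ∀ n (g : A → ℕ) xs → ∑[ x ∈ xs ] (g x * n) ≡ ∑ xs g * n
  ∑-*ʳ n g []       = refl
  ∑-*ʳ n g (x ∷ xs) = trans (cong (g x * n +_) (∑-*ʳ n g xs)) (sym (ℕ.*-distribʳ-+ n (g x) (∑ xs g)))

  ∑-++ : ∀ (g : A → ℕ) xs ys → ∑ (xs ++ ys) g ≡ ∑ xs g + ∑ ys g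
  ∑-++ g []       ys = refl
  ∑-++ g (x ∷ xs) ys = trans (cong (g x +_) (∑-++ g xs ys)) (sym (ℕ.+-assoc (g x) (∑ xs g) (∑ ys g)))

  ∑-map : ∀ (g : B → ℕ) (h : A → B) xs → ∑ (map h xs) g ≡ ∑[ x ∈ xs ] g (h x)
  ∑-map g h []       = refl
  ∑-map g h (x ∷ xs) = cong (g (h x) +_) (∑-map g h xs)

  ∑-cartesianProduct : ∀ (g : A × B → ℕ) xs ys →
    ∑ (cartesianProduct xs ys) g ≡ ∑[ x ∈ xs ] ∑[ y ∈ ys ] g (x , y)
  ∑-cartesianProduct g []       ys = refl
  ∑-cartesianProduct g (x ∷ xs) ys = begin
    ∑ (map (x ,_) ys ++ cartesianProduct xs ys) g              ≡⟨ ∑-++ g (map (x ,_) ys) _ ⟩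
    ∑ (map (x ,_) ys) g + ∑ (cartesianProduct xs ys) g        ≡⟨ cong₂ _+_ (∑-map g (x ,_) ys) (∑-cartesianProduct g xs ys) ⟩
    ∑[ y ∈ ys ] g (x , y) + ∑[ x' ∈ xs ] ∑[ y ∈ ys ] g (x' , y) ∎
    where open ≡-Reasoning

  ∑-comm : ∀ (g : A → B → ℕ) xs ys → ∑[ x ∈ xs ] ∑[ y ∈ ys ] g x y ≡ ∑[ y ∈ ys ] ∑[ x ∈ xs ] g x y
  ∑-comm g []       ys = sym (∑-zero ys)
  ∑-comm g (x ∷ xs) ys = trans (cong (∑ ys (g x) +_) (∑-comm g xs ys)) (sym (∑-+ (g x) _ ys))

  ∣-∑ : ∀ {d} {g : A → ℕ} xs → (∀ {x} → x ∈ xs → d ∣ g x) → d ∣ ∑ xs g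
  ∣-∑ {d = d} []       d∣g = d ∣0
  ∣-∑         (x ∷ xs) d∣g = ∣m∣n⇒∣m+n (d∣g (here refl)) (∣-∑ xs (d∣g ∘ there))

  𝟙 : Bool → ℕ
  𝟙 b = if b then 1 else 0

  count : (A → Bool) → List A → ℕ
  count f xs = ∑[ x ∈ xs ] 𝟙 (f x)

  length-filterᵇ : ∀ (f : A → Bool) xs → length (filterᵇ f xs) ≡ count f xs
  length-filterᵇ f []       = refl
  length-filterᵇ f (x ∷ xs) with f x
  ... | true  = cong suc (length-filterᵇ f xs)
  ... | false = length-filterᵇ f xs

  count-filterᵇ : ∀ (f g : A → Bool) xs → count g (filterᵇ f xs) ≡ count (λ x → f x ∧ g x) xs
  count-filterᵇ f g []       = refl
  count-filterᵇ f g (x ∷ xs) with f x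
  ... | true  = cong (𝟙 (g x) +_) (count-filterᵇ f g xs)
  ... | false = count-filterᵇ f g xs

  count-cong : ∀ {f g : A → Bool} xs → (∀ {x} → x ∈ xs → T (f x) ⇔ T (g x)) → count f xs ≡ count g xs
  count-cong {f = f} {g} xs f⇔g = ∑-cong xs (λ x∈xs → 𝟙-cong (f⇔g x∈xs))
    where
    𝟙-cong : ∀ {a b} → T a ⇔ T b → 𝟙 a ≡ 𝟙 b
    𝟙-cong {false} {false} _   = refl
    𝟙-cong {false} {true}  a⇔b = ⊥-elim (Equivalence.from a⇔b tt)
    𝟙-cong {true}  {false} a⇔b = ⊥-elim (Equivalence.to a⇔b tt)
    𝟙-cong {true}  {true}  _   = refl

  count-∨ : ∀ {f g : A → Bool} xs → (∀ {x} → x ∈ xs → T (f x) → ¬ T (g x)) →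
    count (λ x → f x ∨ g x) xs ≡ count f xs + count g xs
  count-∨ {f = f} {g} xs disjoint = trans (∑-cong xs (λ x∈xs → 𝟙-∨ (disjoint x∈xs))) (∑-+ (𝟙 ∘ f) (𝟙 ∘ g) xs)
    where
    𝟙-∨ : ∀ {a b} → (T a → ¬ T b) → 𝟙 (a ∨ b) ≡ 𝟙 a + 𝟙 b
    𝟙-∨ {false}         _    = refl
    𝟙-∨ {true}  {false} _    = refl
    𝟙-∨ {true}  {true}  a⇒¬b = ⊥-elim (a⇒¬b tt tt)

  count-× : ∀ (f : A → Bool) (g : B → Bool) xs ys →
    count (λ xy → f (proj₁ xy) ∧ g (proj₂ xy)) (cartesianProduct xs ys) ≡ count f xs * count g ys
  count-× f g xs ys = begin
    ∑ (cartesianProduct xs ys) (λ xy → 𝟙 (f (proj₁ xy) ∧ g (proj₂ xy))) ≡⟨ ∑-cartesianProduct _ xs ys ⟩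
    ∑[ x ∈ xs ] ∑[ y ∈ ys ] 𝟙 (f x ∧ g y)   ≡⟨ ∑-cong xs (λ {x} _ → ∑-cong ys (λ {y} _ → 𝟙-∧ (f x) (g y))) ⟩
    ∑[ x ∈ xs ] ∑[ y ∈ ys ] (𝟙 (f x) * 𝟙 (g y)) ≡⟨ ∑-cong xs (λ {x} _ → ∑-*ˡ (𝟙 (f x)) (𝟙 ∘ g) ys) ⟩
    ∑[ x ∈ xs ] (𝟙 (f x) * count g ys)       ≡⟨ ∑-*ʳ (count g ys) (𝟙 ∘ f) xs ⟩
    count f xs * count g ys                   ∎
    where
    open ≡-Reasoning
    𝟙-∧ : ∀ a b → 𝟙 (a ∧ b) ≡ 𝟙 a * 𝟙 b
    𝟙-∧ false b = refl
    𝟙-∧ true  b = sym (ℕ.+-identityʳ (𝟙 b))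

  count-none : ∀ {f : A → Bool} xs → (∀ {x} → x ∈ xs → ¬ T (f x)) → count f xs ≡ 0
  count-none {f = f} xs none = trans (∑-cong xs (λ x∈xs → 𝟙-false (none x∈xs))) (∑-zero xs)
    where
    𝟙-false : ∀ {a} → ¬ T a → 𝟙 a ≡ 0
    𝟙-false {false} _  = refl
    𝟙-false {true}  ¬a = ⊥-elim (¬a tt)

  count-unique : ∀ {f : A → Bool} {a} xs → Unique xs → a ∈ xs → T (f a) →
    (∀ {x} → x ∈ xs → T (f x) → x ≡ a) → count f xs ≡ 1
  count-unique {f = f} (x ∷ xs) (x∉xs ∷ _) (here refl) fa only with f x
  ... | true  = cong suc (count-none xs (λ x'∈xs fx' → All.lookup x∉xs x'∈xs (sym (only (there x'∈xs) fx'))))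
  count-unique {f = f} (x ∷ xs) (x∉xs ∷ xs!) (there a∈xs) fa only with f x in fx
  ... | true  = ⊥-elim (All.lookup x∉xs a∈xs (only (here refl) (subst T (sym fx) tt)))
  ... | false = count-unique xs xs! a∈xs fa (only ∘ there)

  count≡0⊎witness : ∀ (f : A → Bool) xs → count f xs ≡ 0 ⊎ ∃ λ x → x ∈ xs × T (f x)
  count≡0⊎witness f []       = inj₁ refl
  count≡0⊎witness f (x ∷ xs) with f x in fx
  ... | true  = inj₂ (x , here refl , subst T (sym fx) tt)
  ... | false with count≡0⊎witness f xs
  ...   | inj₁ none            = inj₁ none
  ...   | inj₂ (y , y∈xs , fy) = inj₂ (y , there y∈xs , fy)

  count-∷-reject : ∀ {f : A → Bool} {x} xs → ¬ T (f x) → count f (x ∷ xs) ≡ count f xs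
  count-∷-reject {f = f} {x} xs ¬fx with f x
  ... | false = refl
  ... | true  = ⊥-elim (¬fx tt)

module FreshmansDream where

  open import Data.Empty using (⊥-elim)
  open import Function using (id; _∘_)
  open import Data.Fin as Fin using (Fin; toℕ; inject₁; fromℕ)
  import Data.Fin.Properties as Fin
  open import Data.Nat using (ℕ; zero; suc; _+_; _*_; _∸_; _^_; _<_; _≤_; _!; z≤n; s≤s; nonTrivial⇒n>1)
  open import Data.Nat.Combinatorics using (_C_; nCn≡1; nCk≡n!/k![n-k]!; k![n∸k]!∣n!)
  open import Data.Nat.DivMod using (m*[n/m]≡n)
  open import Data.Nat.Divisibility using (_∣_; ∣-refl; ∣m⇒∣m*n; _∣0; ∣m∣n⇒∣m+n; ∣⇒≤)
  import Data.Nat.Properties as ℕ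
  open import Data.Nat.Primality using (Prime; euclidsLemma; prime⇒nonTrivial; ¬prime[0])
  open import Data.Sum using (inj₁; inj₂; [_,_]′)
  open import Data.Product using (∃; _×_; _,_)
  open import Data.Vec.Functional using (Vector; tail; init; last)
  open import Relation.Nullary using (¬_)
  open import Relation.Binary.PropositionalEquality using (_≡_; refl; sym; trans; cong; cong₂; subst; module ≡-Reasoning)

  import Algebra.Properties.CommutativeSemiring.Binomial ℕ.+-*-commutativeSemiring as Binomial
  import Algebra.Properties.Semiring.Exp ℕ.+-*-semiring as Exp
  import Algebra.Properties.Monoid.Sum ℕ.+-0-monoid as Sum
  import Algebra.Definitions.RawMonoid Data.Nat.+-0-rawMonoid as Multiple

  n∣n! : ∀ {n} → 0 < n → n ∣ n !
  n∣n! {suc n} _ = ∣m⇒∣m*n (n !) ∣-refl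

  k!*[n∸k]!*nCk≡n! : ∀ {n k} → k ≤ n → (k ! * (n ∸ k) !) * (n C k) ≡ n !
  k!*[n∸k]!*nCk≡n! {n} {k} k≤n =
    trans (cong (k ! * (n ∸ k) ! *_) (nCk≡n!/k![n-k]! k≤n)) (m*[n/m]≡n (k![n∸k]!∣n! k≤n))
    where instance _ = k ℕ.!* (n ∸ k) !≢0

  module _ {p} (p-prime : Prime p) where

    prime>1 : 1 < p
    prime>1 = nonTrivial⇒n>1 p {{prime⇒nonTrivial p-prime}}

    prime∤! : ∀ {m} → m < p → ¬ p ∣ m !
    prime∤! {zero}  m<p p∣1 = ℕ.<⇒≱ prime>1 (∣⇒≤ p∣1)
    prime∤! {suc m} m<p p∣m! with euclidsLemma (suc m) (m !) p-prime p∣m!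
    ... | inj₁ p∣1+m = ℕ.<⇒≱ m<p (∣⇒≤ p∣1+m)
    ... | inj₂ p∣m!  = prime∤! (ℕ.<-trans (ℕ.n<1+n m) m<p) p∣m!

    prime∣binomial : ∀ {k} → 0 < k → k < p → p ∣ p C k
    prime∣binomial {k} 0<k k<p =
      [ ⊥-elim ∘ p∤k![p-k]! , id ]′ (euclidsLemma (k ! * (p ∸ k) !) (p C k) p-prime p∣product)
      where
      p∣product : p ∣ (k ! * (p ∸ k) !) * (p C k)
      p∣product = subst (p ∣_) (sym (k!*[n∸k]!*nCk≡n! (ℕ.<⇒≤ k<p))) (n∣n! (ℕ.<-trans (s≤s z≤n) prime>1))
      p∤k![p-k]! : ¬ p ∣ k ! * (p ∸ k) !
      p∤k![p-k]! = [ prime∤! k<p , prime∤! (ℕ.∸-monoʳ-< 0<k (ℕ.<⇒≤ k<p)) ]′ ∘ euclidsLemma (k !) ((p ∸ k) !) p-prime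

  binomial-middle : ℕ → ℕ → ℕ
  binomial-middle a m = Sum.sum (init (tail (Binomial.binomialTerm a 1 (suc m))))

  private
    ^≡Exp^ : ∀ x n → x ^ n ≡ x Exp.^ n
    ^≡Exp^ x zero    = refl
    ^≡Exp^ x (suc n) = cong (x *_) (^≡Exp^ x n)

    ×≡* : ∀ n x → n Multiple.× x ≡ n * x
    ×≡* zero    x = refl
    ×≡* (suc n) x = cong (x +_) (×≡* n x)

    binomialTerm≡ : ∀ a n (k : Fin (suc n)) →
      Binomial.binomialTerm a 1 n k ≡ (n C toℕ k) * a ^ toℕ k
    binomialTerm≡ a n k = begin
      c Multiple.× (a Exp.^ i * 1 Exp.^ (n ∸ i)) ≡⟨ ×≡* c _ ⟩
      c * (a Exp.^ i * 1 Exp.^ (n ∸ i))          ≡⟨ cong (c *_) (cong₂ _*_ (sym (^≡Exp^ a i)) (sym (^≡Exp^ 1 (n ∸ i)))) ⟩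
      c * (a ^ i * 1 ^ (n ∸ i))                  ≡⟨ cong (λ t → c * (a ^ i * t)) (ℕ.^-zeroˡ (n ∸ i)) ⟩
      c * (a ^ i * 1)                            ≡⟨ cong (c *_) (ℕ.*-identityʳ (a ^ i)) ⟩
      c * a ^ i                                  ∎
      where
      open ≡-Reasoning
      i = toℕ k
      c = n C i

  binomial-+1 : ∀ a m → (a + 1) ^ suc m ≡ 1 + (binomial-middle a m + a ^ suc m)
  binomial-+1 a m = begin
    (a + 1) ^ n                               ≡⟨ ^≡Exp^ (a + 1) n ⟩
    (a + 1) Exp.^ n                           ≡⟨ Binomial.theorem n a 1 ⟩
    Sum.sum terms                             ≡⟨ cong (_+ Sum.sum (tail terms)) first≡1 ⟩
    1 + Sum.sum (tail terms)                  ≡⟨ cong (1 +_) (Sum.sum-init-last (tail terms)) ⟩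
    1 + (binomial-middle a m + last (tail terms))
                                              ≡⟨ cong (λ t → 1 + (binomial-middle a m + t)) last≡a^n ⟩
    1 + (binomial-middle a m + a ^ n)         ∎
    where
    open ≡-Reasoning
    n = suc m
    terms = Binomial.binomialTerm a 1 n
    first≡1 : terms Fin.zero ≡ 1
    first≡1 = binomialTerm≡ a n Fin.zero
    last≡a^n : last (tail terms) ≡ a ^ n
    last≡a^n = begin
      terms (fromℕ n)            ≡⟨ binomialTerm≡ a n (fromℕ n) ⟩
      (n C toℕ (fromℕ n)) * a ^ toℕ (fromℕ n) ≡⟨ cong (λ k → (n C k) * a ^ k) (Fin.toℕ-fromℕ n) ⟩
      (n C n) * a ^ n            ≡⟨ cong (_* a ^ n) (nCn≡1 n) ⟩
      1 * a ^ n                  ≡⟨ ℕ.*-identityˡ (a ^ n) ⟩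
      a ^ n                      ∎

  ∣binomial-middle : ∀ {d} a m → (∀ {k} → 0 < k → k < suc m → d ∣ suc m C k) → d ∣ binomial-middle a m
  ∣binomial-middle {d} a m d∣nCk = ∣-sum m (init (tail terms)) d∣term
    where
    terms = Binomial.binomialTerm a 1 (suc m)
    ∣-sum : ∀ l (t : Vector ℕ l) → (∀ i → d ∣ t i) → d ∣ Sum.sum t
    ∣-sum zero    t d∣t = d ∣0
    ∣-sum (suc l) t d∣t = ∣m∣n⇒∣m+n (d∣t Fin.zero) (∣-sum l (tail t) (λ i → d∣t (Fin.suc i)))
    d∣term : ∀ i → d ∣ terms (Fin.suc (inject₁ i))
    d∣term i = subst (d ∣_) (sym (binomialTerm≡ a (suc m) (Fin.suc (inject₁ i))))
      (∣m⇒∣m*n _ (d∣nCk (s≤s z≤n) (s≤s (subst (_< m) (sym (Fin.toℕ-inject₁ i)) (Fin.toℕ<n i)))))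

  freshman's-dream : ∀ {p} → Prime p → ∀ a → ∃ λ M → p ∣ M × (a + 1) ^ p ≡ 1 + (M + a ^ p)
  freshman's-dream {zero}  p-prime a = ⊥-elim (¬prime[0] p-prime)
  freshman's-dream {suc m} p-prime a =
    binomial-middle a m , ∣binomial-middle a m (prime∣binomial p-prime) , binomial-+1 a m

module PolynomialFunctions where

  open import Data.Integer using (ℤ; _+_; _*_; -_; _-_; _^_; 0ℤ; 1ℤ)
  open import Data.Integer.Tactic.RingSolver using (solve-∀; solve)
  open import Data.List using ([]; _∷_)
  import Data.Integer.Properties as ℤ
  open import Data.Nat using (ℕ; zero; suc; _<_)
  open import Data.Product using (Σ; ∃₂; _×_; _,_)
  open import Relation.Binary.PropositionalEquality using (_≡_; refl; sym; trans; cong; cong₂; module ≡-Reasoning)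

  Poly< : ℕ → (ℤ → ℤ) → Set
  Poly< zero    f = ∀ x → f x ≡ 0ℤ
  Poly< (suc n) f = ∃₂ λ c g → Poly< n g × (∀ x → f x ≡ c + x * g x)

  Monic : ℕ → (ℤ → ℤ) → Set
  Monic zero    f = ∀ x → f x ≡ 1ℤ
  Monic (suc n) f = ∃₂ λ c g → Monic n g × (∀ x → f x ≡ c + x * g x)

  poly-zero : ∀ n → Poly< n (λ _ → 0ℤ)
  poly-zero zero    x = refl
  poly-zero (suc n) = 0ℤ , (λ _ → 0ℤ) , poly-zero n , λ x → solve (x ∷ [])

  poly-const : ∀ n c → Poly< (suc n) (λ _ → c)
  poly-const n c = c , (λ _ → 0ℤ) , poly-zero n , λ x → solve (c ∷ x ∷ [])

  poly-*ˡ : ∀ n r {f} → Poly< n f → Poly< n (λ x → r * f x)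
  poly-*ˡ zero    r f≡0 x = trans (cong (r *_) (f≡0 x)) (solve (r ∷ []))
  poly-*ˡ (suc n) r {f} (c , g , g-poly , f≡) = r * c , (λ x → r * g x) , poly-*ˡ n r g-poly ,
    λ x → trans (cong (r *_) (f≡ x)) (distrib r c x (g x))
    where
    distrib : ∀ r c x y → r * (c + x * y) ≡ r * c + x * (r * y)
    distrib = solve-∀

  monic⇒poly : ∀ n {f} → Monic n f → Poly< (suc n) f
  monic⇒poly zero    f≡1 = 1ℤ , (λ _ → 0ℤ) , (λ _ → refl) , λ x → trans (f≡1 x) (solve (x ∷ []))
  monic⇒poly (suc n) (c , g , g-monic , f≡) = c , g , monic⇒poly n g-monic , f≡

  monic-+ : ∀ n {f h} → Monic n f → Poly< n h → Monic n (λ x → f x + h x)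
  monic-+ zero    f≡1 h≡0 x = trans (cong₂ _+_ (f≡1 x) (h≡0 x)) refl
  monic-+ (suc n) {f} {h} (c , g , g-monic , f≡) (d , k , k-poly , h≡) =
    c + d , (λ x → g x + k x) , monic-+ n g-monic k-poly ,
    λ x → trans (cong₂ _+_ (f≡ x) (h≡ x)) (collect c d x (g x) (k x))
    where
    collect : ∀ c d x g k → (c + x * g) + (d + x * k) ≡ (c + d) + x * (g + k)
    collect = solve-∀

  monic-^ : ∀ n → Monic n (_^ n)
  monic-^ zero    x = refl
  monic-^ (suc n) = 0ℤ , _^ n , monic-^ n , λ x → sym (ℤ.+-identityˡ (x ^ suc n))

  monic-factor : ∀ n {f} → Monic (suc n) f → ∀ r →
    Σ (ℤ → ℤ) λ q → Monic n q × (∀ x → f x - f r ≡ (x - r) * q x)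
  monic-factor zero {f} (c , g , g≡1 , f≡) r = g , g≡1 , λ x → begin
    f x - f r                     ≡⟨ cong₂ _-_ (f≡ x) (f≡ r) ⟩
    (c + x * g x) - (c + r * g r) ≡⟨ cong₂ (λ s t → (c + x * s) - (c + r * t)) (g≡1 x) (g≡1 r) ⟩
    (c + x * 1ℤ) - (c + r * 1ℤ)   ≡⟨ solve (c ∷ x ∷ r ∷ []) ⟩
    (x - r) * 1ℤ                  ≡⟨ cong ((x - r) *_) (sym (g≡1 x)) ⟩
    (x - r) * g x                 ∎
    where open ≡-Reasoning
  monic-factor (suc n) {f} (c , g , g-monic , f≡) r with monic-factor n g-monic r
  ... | q , q-monic , g-factor =
    (λ x → g x + r * q x) , monic-+ (suc n) g-monic (poly-*ˡ (suc n) r (monic⇒poly n q-monic)) , λ x → begin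
      f x - f r                             ≡⟨ cong₂ _-_ (f≡ x) (f≡ r) ⟩
      (c + x * g x) - (c + r * g r)         ≡⟨ split c x r (g x) (g r) ⟩
      (x - r) * g x + r * (g x - g r)       ≡⟨ cong (λ t → (x - r) * g x + r * t) (g-factor x) ⟩
      (x - r) * g x + r * ((x - r) * q x)   ≡⟨ merge x r (g x) (q x) ⟩
      (x - r) * (g x + r * q x)             ∎
    where
    open ≡-Reasoning
    split : ∀ c x r gx gr → (c + x * gx) - (c + r * gr) ≡ (x - r) * gx + r * (gx - gr)
    split = solve-∀
    merge : ∀ x r gx qx → (x - r) * gx + r * ((x - r) * qx) ≡ (x - r) * (gx + r * qx)
    merge = solve-∀

  monic-^-1 : ∀ n → 0 < n → Monic n (λ x → x ^ n - 1ℤ)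
  monic-^-1 (suc n) _ = monic-+ (suc n) (monic-^ (suc n)) (poly-const n (- 1ℤ))

module IntegersModPrime (p : ℕ) .{{_ : NonZero p}} (p-prime : Prime p) where

  open import Data.Bool using (Bool; true; false; T; _∧_; _∨_; if_then_else_)
  open import Data.Bool.ListAction using (any)
  open import Data.Bool.Properties using (T-≡; T-∧; T-∨)
  open import Data.Empty using (⊥-elim)
  open import Data.Integer using (ℤ; +_; _+_; _*_; -_; _-_; _^_; 0ℤ; 1ℤ; ∣_∣) renaming (_⊖_ to _⊖ℕ_)
  open import Data.Integer.DivMod using (_%ℕ_; _/ℕ_; a≡a%ℕn+[a/ℕn]*n; n%ℕd<d)
  open import Data.Integer.Divisibility.Signed
    using (_∣_; divides; _∣?_; ∣-refl; ∣m∣n⇒∣m+n; ∣m⇒∣-m; ∣n⇒∣m*n; ∣m⇒∣m*n; ∣⇒∣ᵤ; ∣ᵤ⇒∣)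
  import Data.Integer.Properties as ℤ
  open import Data.Integer.Tactic.RingSolver using (solve-∀)
  open import Data.List using (List; []; _∷_; length; upTo; applyUpTo; filterᵇ; cartesianProduct)
  open import Data.List.Membership.Propositional using (_∈_; find)
  open import Data.List.Membership.Propositional.Properties using (∈-upTo⁺; ∈-upTo⁻; ∈-applyUpTo⁻)
  open import Data.List.Properties using (length-applyUpTo)
  open import Data.List.Relation.Unary.All using ([]; _∷_)
  import Data.List.Relation.Unary.All as All
  open import Data.List.Relation.Unary.AllPairs using (AllPairs; []; _∷_)
  open import Data.List.Relation.Unary.AllPairs.Properties using (applyUpTo⁺₁)
  open import Data.List.Relation.Unary.Any using (Any; here; there)
  import Data.List.Relation.Unary.Any as Any
  open import Data.List.Relation.Unary.Any.Properties using (any⁺; any⁻)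
  open import Data.List.Relation.Unary.Unique.Propositional.Properties using (upTo⁺)
  open import Data.Maybe using (nothing; just)
  open import Data.Nat as ℕ using (zero; suc; _<_; z≤n; s≤s) renaming (_+_ to _+ℕ_)
  open import Data.Nat.DivMod using (m%n<n)
  import Data.Nat.Divisibility as ℕ
  open import Data.Nat.Primality using (euclidsLemma)
  import Data.Nat.Properties as ℕ
  open import Data.Product using (Σ; ∃; _×_; _,_; proj₁; proj₂)
  open import Data.Product.Function.NonDependent.Propositional using (_×-⇔_)
  open import Data.Sum using (_⊎_; inj₁; inj₂; [_,_]′)
  import Data.Sum as Sum
  open import Data.Sum.Function.Propositional using (_⊎-⇔_)
  open import Function using (id; _∘_; _⇔_; mk⇔; Equivalence)
  import Function.Properties.Equivalence as ⇔
  open import Relation.Binary.Bundles using (Setoid)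
  open import Relation.Binary.PropositionalEquality
    using (_≡_; _≢_; refl; sym; trans; cong; cong₂; subst; module ≡-Reasoning)
  import Relation.Binary.Reasoning.Setoid as SetoidReasoning
  open import Relation.Nullary using (¬_; Dec; yes; no)
  open import Relation.Nullary.Decidable using (⌊_⌋; map′; toWitness; fromWitness)

  open Counting
  open FreshmansDream
  open PolynomialFunctions

  infix 4 _≈_ _≉_ _≈?_ _≈ᵇ_

  -- A record rather than a synonym for + p ∣ i - j, so that i and j can be inferred from a proof.
  record _≈_ (i j : ℤ) : Set where
    constructor mod-p
    field p∣i-j : + p ∣ i - j

  open _≈_

  _≉_ : ℤ → ℤ → Set
  i ≉ j = ¬ i ≈ j

  private
    P : ℤ
    P = + p

  ≈-reflexive : ∀ {i j} → i ≡ j → i ≈ j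
  ≈-reflexive {i} refl = mod-p (subst (P ∣_) (sym (ℤ.+-inverseʳ i)) (divides 0ℤ refl))

  ≈-refl : ∀ {i} → i ≈ i
  ≈-refl = ≈-reflexive refl

  ≈-sym : ∀ {i j} → i ≈ j → j ≈ i
  ≈-sym {i} {j} (mod-p d) = mod-p (subst (P ∣_) (negate i j) (∣m⇒∣-m d))
    where
    negate : ∀ i j → - (i - j) ≡ j - i
    negate = solve-∀

  ≈-trans : ∀ {i j k} → i ≈ j → j ≈ k → i ≈ k
  ≈-trans {i} {j} {k} (mod-p d) (mod-p e) = mod-p (subst (P ∣_) (telescope i j k) (∣m∣n⇒∣m+n d e))
    where
    telescope : ∀ i j k → (i - j) + (j - k) ≡ i - k
    telescope = solve-∀

  ≈-setoid : Setoid _ _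
  ≈-setoid = record
    { Carrier = ℤ ; _≈_ = _≈_
    ; isEquivalence = record { refl = ≈-refl ; sym = ≈-sym ; trans = ≈-trans } }

  module ≈-Reasoning = SetoidReasoning ≈-setoid

  +-cong : ∀ {i i' j j'} → i ≈ i' → j ≈ j' → i + j ≈ i' + j'
  +-cong {i} {i'} {j} {j'} (mod-p d) (mod-p e) = mod-p (subst (P ∣_) (regroup i i' j j') (∣m∣n⇒∣m+n d e))
    where
    regroup : ∀ i i' j j' → (i - i') + (j - j') ≡ (i + j) - (i' + j')
    regroup = solve-∀

  -‿cong : ∀ {i i'} → i ≈ i' → - i ≈ - i'
  -‿cong {i} {i'} (mod-p d) = mod-p (subst (P ∣_) (negate i i') (∣m⇒∣-m d))
    where
    negate : ∀ i i' → - (i - i') ≡ - i - - i'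
    negate = solve-∀

  sub-cong : ∀ {i i' j j'} → i ≈ i' → j ≈ j' → i - j ≈ i' - j'
  sub-cong i≈i' j≈j' = +-cong i≈i' (-‿cong j≈j')

  *-cong : ∀ {i i' j j'} → i ≈ i' → j ≈ j' → i * j ≈ i' * j'
  *-cong {i} {i'} {j} {j'} (mod-p d) (mod-p e) =
    mod-p (subst (P ∣_) (regroup i i' j j') (∣m∣n⇒∣m+n (∣m⇒∣m*n j d) (∣n⇒∣m*n i' e)))
    where
    regroup : ∀ i i' j j' → (i - i') * j + i' * (j - j') ≡ i * j - i' * j'
    regroup = solve-∀

  ^-cong : ∀ {i j} n → i ≈ j → i ^ n ≈ j ^ n
  ^-cong zero    i≈j = ≈-refl
  ^-cong (suc n) i≈j = *-cong i≈j (^-cong n i≈j)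

  ≈⇒-≈0 : ∀ {i j} → i ≈ j → i - j ≈ 0ℤ
  ≈⇒-≈0 {i} {j} i≈j = ≈-trans (sub-cong i≈j (≈-refl {j})) (≈-reflexive (ℤ.+-inverseʳ j))

  -≈0⇒≈ : ∀ {i j} → i - j ≈ 0ℤ → i ≈ j
  -≈0⇒≈ {i} {j} (mod-p d) = mod-p (subst (P ∣_) (ℤ.+-identityʳ (i - j)) d)

  ∣⇒≈0 : ∀ {i} → P ∣ i → i ≈ 0ℤ
  ∣⇒≈0 {i} d = mod-p (subst (P ∣_) (sym (ℤ.+-identityʳ i)) d)

  ≈0⇒∣ : ∀ {i} → i ≈ 0ℤ → P ∣ i
  ≈0⇒∣ {i} (mod-p d) = subst (P ∣_) (ℤ.+-identityʳ i) d

  i*j≈0⇒i≈0⊎j≈0 : ∀ {i j} → i * j ≈ 0ℤ → i ≈ 0ℤ ⊎ j ≈ 0ℤ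
  i*j≈0⇒i≈0⊎j≈0 {i} {j} ij≈0
    with euclidsLemma ∣ i ∣ ∣ j ∣ p-prime (subst (p ℕ.∣_) (ℤ.abs-* i j) (∣⇒∣ᵤ (≈0⇒∣ ij≈0)))
  ... | inj₁ p∣i = inj₁ (∣⇒≈0 (∣ᵤ⇒∣ p∣i))
  ... | inj₂ p∣j = inj₂ (∣⇒≈0 (∣ᵤ⇒∣ p∣j))

  *-≉0 : ∀ {i j} → i ≉ 0ℤ → j ≉ 0ℤ → i * j ≉ 0ℤ
  *-≉0 i≉0 j≉0 ij≈0 = [ i≉0 , j≉0 ]′ (i*j≈0⇒i≈0⊎j≈0 ij≈0)

  -‿≉0 : ∀ {i} → i ≉ 0ℤ → - i ≉ 0ℤ
  -‿≉0 {i} i≉0 -i≈0 = i≉0 (≈-trans (≈-reflexive (sym (ℤ.neg-involutive i))) (-‿cong -i≈0))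

  *-cancelˡ-≈ : ∀ {i j k} → i ≉ 0ℤ → i * j ≈ i * k → j ≈ k
  *-cancelˡ-≈ {i} {j} {k} i≉0 ij≈ik =
    [ ⊥-elim ∘ i≉0 , -≈0⇒≈ ]′ (i*j≈0⇒i≈0⊎j≈0 (≈-trans (≈-reflexive (factor i j k)) (≈⇒-≈0 ij≈ik)))
    where
    factor : ∀ i j k → i * (j - k) ≡ i * j - i * k
    factor = solve-∀

  p≈0 : P ≈ 0ℤ
  p≈0 = ∣⇒≈0 ∣-refl

  residue≈ : ∀ i → + (i %ℕ p) ≈ i
  residue≈ i = ≈-sym (mod-p (divides (i /ℕ p) i-r≡qp))
    where
    open ≡-Reasoning
    r = + (i %ℕ p)
    q = i /ℕ p
    cancel : ∀ r q P → (r + q * P) - r ≡ q * P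
    cancel = solve-∀
    i-r≡qp : i - r ≡ q * P
    i-r≡qp = begin
      i - r             ≡⟨ cong (_- r) (a≡a%ℕn+[a/ℕn]*n i p) ⟩
      (r + q * P) - r   ≡⟨ cancel r q P ⟩
      q * P             ∎

  residue-injective : ∀ {m n} → m < p → n < p → + m ≈ + n → m ≡ n
  residue-injective {m} {n} m<p n<p (mod-p d) =
    ℤ.+-injective (ℤ.i-j≡0⇒i≡j (+ m) (+ n) (trans (ℤ.m-n≡m⊖n m n) (ℤ.∣i∣≡0⇒i≡0 ∣m⊖n∣≡0)))
    where
    ∣m⊖n∣≡0 : ∣ m ⊖ℕ n ∣ ≡ 0
    ∣m⊖n∣≡0 with ∣ m ⊖ℕ n ∣ in eq
    ... | zero  = refl
    ... | suc _ = ⊥-elim (ℕ.<⇒≱ (subst (_< p) eq (ℕ.≤-<-trans (ℤ.∣m⊝n∣≤m⊔n m n) (ℕ.⊔-lub m<p n<p)))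
                                  (ℕ.∣⇒≤ (subst (p ℕ.∣_) eq (∣⇒∣ᵤ (subst (P ∣_) (ℤ.m-n≡m⊖n m n) d)))))

  residue≉0 : ∀ {m} → 0 < m → m < p → + m ≉ 0ℤ
  residue≉0 {suc m} _ m<p m≈0 with residue-injective m<p (ℕ.<-trans (s≤s z≤n) m<p) m≈0
  ... | ()

  1≉0 : 1ℤ ≉ 0ℤ
  1≉0 = residue≉0 (s≤s z≤n) (prime>1 p-prime)

  _≈?_ : ∀ i j → Dec (i ≈ j)
  i ≈? j = map′ mod-p p∣i-j (P ∣? (i - j))

  _≈ᵇ_ : ℤ → ℤ → Bool
  i ≈ᵇ j = ⌊ i ≈? j ⌋

  T-≈ᵇ : ∀ {i j} → T (i ≈ᵇ j) ⇔ i ≈ j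
  T-≈ᵇ = mk⇔ toWitness fromWitness

  ≈-resp-⇔ : ∀ {i i' j j'} → i ≈ i' → j ≈ j' → i ≈ j ⇔ i' ≈ j'
  ≈-resp-⇔ i≈i' j≈j' = mk⇔ (λ i≈j → ≈-trans (≈-sym i≈i') (≈-trans i≈j j≈j'))
                           (λ i'≈j' → ≈-trans i≈i' (≈-trans i'≈j' (≈-sym j≈j')))

  residues : List ℕ
  residues = upTo p

  nonzero-residues : List ℕ
  nonzero-residues = applyUpTo suc (ℕ.pred p)

  residues≡0∷nonzero : residues ≡ 0 ∷ nonzero-residues
  residues≡0∷nonzero = cong upTo (sym (ℕ.suc-pred p))

  suc<p : ∀ {i} → i < ℕ.pred p → suc i < p
  suc<p {i} i<p-1 = subst (suc i <_) (ℕ.suc-pred p) (s≤s i<p-1)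

  count-residues≈ : ∀ i → count (λ x → + x ≈ᵇ i) residues ≡ 1
  count-residues≈ i = count-unique residues (upTo⁺ p) (∈-upTo⁺ r<p) (Equivalence.from T-≈ᵇ (residue≈ i))
    (λ x∈ x≈i → residue-injective (∈-upTo⁻ x∈) r<p (≈-trans (Equivalence.to T-≈ᵇ x≈i) (≈-sym (residue≈ i))))
    where
    r<p = n%ℕd<d i p

  count-residues-any≈ : ∀ rs → AllPairs _≉_ rs → count (λ x → any (λ r → + x ≈ᵇ r) rs) residues ≡ length rs
  count-residues-any≈ []       _            = count-none residues (λ _ ())
  count-residues-any≈ (r ∷ rs) (r≉rs ∷ rs!) = begin
    count (λ x → (+ x ≈ᵇ r) ∨ any (λ r' → + x ≈ᵇ r') rs) residues
      ≡⟨ count-∨ residues disjoint ⟩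
    count (λ x → + x ≈ᵇ r) residues +ℕ count (λ x → any (λ r' → + x ≈ᵇ r') rs) residues
      ≡⟨ cong₂ _+ℕ_ (count-residues≈ r) (count-residues-any≈ rs rs!) ⟩
    suc (length rs) ∎
    where
    open ≡-Reasoning
    disjoint : ∀ {x} → x ∈ residues → T (+ x ≈ᵇ r) → ¬ T (any (λ r' → + x ≈ᵇ r') rs)
    disjoint {x} _ x≈r x≈rs with find (any⁻ _ rs x≈rs)
    ... | r' , r'∈rs , x≈r' = All.lookup r≉rs r'∈rs
      (≈-trans (≈-sym (Equivalence.to T-≈ᵇ x≈r)) (Equivalence.to T-≈ᵇ x≈r'))

  solutions : (ℤ → ℤ) → ℤ → ℕ
  solutions F c = count (λ x → F (+ x) ≈ᵇ c) residues

  solutions≡length : ∀ {F c} rs → AllPairs _≉_ rs → (∀ {x} → F x ≈ c ⇔ Any (x ≈_) rs) → solutions F c ≡ length rs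
  solutions≡length {F} {c} rs rs! roots = trans (count-cong residues F≈c⇔any) (count-residues-any≈ rs rs!)
    where
    F≈c⇔any : ∀ {x} → x ∈ residues → T (F (+ x) ≈ᵇ c) ⇔ T (any (λ r → + x ≈ᵇ r) rs)
    F≈c⇔any {x} _ = mk⇔
      (λ t → any⁺ _ (Any.map (Equivalence.from T-≈ᵇ) (Equivalence.to roots (Equivalence.to T-≈ᵇ t))))
      (λ t → Equivalence.from T-≈ᵇ (Equivalence.from roots (Any.map (Equivalence.to T-≈ᵇ) (any⁻ _ rs t))))

  pos-^ : ∀ m n → + (m ℕ.^ n) ≡ (+ m) ^ n
  pos-^ m zero    = refl
  pos-^ m (suc n) = trans (ℤ.pos-* m (m ℕ.^ n)) (cong (+ m *_) (pos-^ m n))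

  fermat-ℕ : ∀ a → + (a ℕ.^ p) ≈ + a
  fermat-ℕ zero    = ≈-reflexive (cong (λ n → + (0 ℕ.^ n)) (sym (ℕ.suc-pred p)))
  fermat-ℕ (suc a) = step (freshman's-dream p-prime a)
    where
    open ≈-Reasoning
    step : ∃ (λ M → p ℕ.∣ M × (a +ℕ 1) ℕ.^ p ≡ 1 +ℕ (M +ℕ a ℕ.^ p)) → + (suc a ℕ.^ p) ≈ + suc a
    step (M , p∣M , expansion) = begin
      + (suc a ℕ.^ p)             ≡⟨ cong (λ t → + (t ℕ.^ p)) (ℕ.+-comm 1 a) ⟩
      + ((a +ℕ 1) ℕ.^ p)          ≡⟨ cong +_ expansion ⟩
      + (1 +ℕ (M +ℕ a ℕ.^ p))     ≡⟨ trans (ℤ.pos-+ 1 (M +ℕ a ℕ.^ p)) (cong (λ t → 1ℤ + t) (ℤ.pos-+ M (a ℕ.^ p))) ⟩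
      1ℤ + (+ M + + (a ℕ.^ p))    ≈⟨ +-cong (≈-refl {1ℤ}) (+-cong (∣⇒≈0 (∣ᵤ⇒∣ {i = + M} p∣M)) (fermat-ℕ a)) ⟩
      1ℤ + (0ℤ + + a)             ≡⟨ cong (λ t → 1ℤ + t) (ℤ.+-identityˡ (+ a)) ⟩
      + suc a                     ∎

  fermat : ∀ i → i ^ p ≈ i
  fermat i = begin
    i ^ p         ≈⟨ ^-cong p (≈-sym (residue≈ i)) ⟩
    (+ r) ^ p     ≡⟨ sym (pos-^ r p) ⟩
    + (r ℕ.^ p)   ≈⟨ fermat-ℕ r ⟩
    + r           ≈⟨ residue≈ i ⟩
    i             ∎
    where
    open ≈-Reasoning
    r = i %ℕ p

  fermat-unit : ∀ {i n} → p ≡ suc n → i ≉ 0ℤ → i ^ n ≈ 1ℤ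
  fermat-unit {i} {n} p≡1+n i≉0 = *-cancelˡ-≈ i≉0 (begin
    i * i ^ n   ≡⟨ cong (i ^_) (sym p≡1+n) ⟩
    i ^ p       ≈⟨ fermat i ⟩
    i           ≡⟨ sym (ℤ.*-identityʳ i) ⟩
    i * 1ℤ      ∎)
    where open ≈-Reasoning

  open Fp p

  ==⇔≈ : ∀ {m n} → T (m == n) ⇔ + m ≈ + n
  ==⇔≈ {m} {n} = mk⇔
    (λ t → ≈-trans (≈-sym (residue≈ (+ m))) (≈-trans (≈-reflexive (cong +_ (ℕ.≡ᵇ⇒≡ _ _ t))) (residue≈ (+ n))))
    (λ m≈n → ℕ.≡⇒≡ᵇ _ _ (residue-injective (m%n<n m p) (m%n<n n p)
      (≈-trans (residue≈ (+ m)) (≈-trans m≈n (≈-sym (residue≈ (+ n)))))))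

  ⊕-≈ : ∀ m n → + (m ⊕ n) ≈ + m + + n
  ⊕-≈ m n = ≈-trans (residue≈ (+ (m +ℕ n))) (≈-reflexive (ℤ.pos-+ m n))

  ⊗-≈ : ∀ m n → + (m ⊗ n) ≈ + m * + n
  ⊗-≈ m n = ≈-trans (residue≈ (+ (m ℕ.* n))) (≈-reflexive (ℤ.pos-* m n))

  ⊝-≈ : ∀ m → + (⊝ m) ≈ - + m
  ⊝-≈ m = begin
    + ((p ℕ.∸ m ℕ.% p) ℕ.% p) ≈⟨ residue≈ (+ (p ℕ.∸ m ℕ.% p)) ⟩
    + (p ℕ.∸ m ℕ.% p)         ≡⟨ sym (trans (ℤ.m-n≡m⊖n p (m ℕ.% p)) (ℤ.⊖-≥ (ℕ.<⇒≤ (m%n<n m p)))) ⟩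
    P - + (m ℕ.% p)           ≈⟨ sub-cong p≈0 (residue≈ (+ m)) ⟩
    0ℤ - + m                  ≡⟨ ℤ.+-identityˡ (- + m) ⟩
    - + m                     ∎
    where open ≈-Reasoning

  ⊖-≈ : ∀ m n → + (m ⊖ n) ≈ + m - + n
  ⊖-≈ m n = ≈-trans (⊕-≈ m (⊝ n)) (+-cong (≈-refl {+ m}) (⊝-≈ n))

  inv-≈ : ∀ m → + m ≉ 0ℤ → + (inv m) * + m ≈ 1ℤ
  inv-≈ m m≉0 = begin
    + (inv m) * + m               ≈⟨ *-cong (residue≈ (+ (m ℕ.^ (p ℕ.∸ 2)))) (≈-refl {+ m}) ⟩
    + (m ℕ.^ (p ℕ.∸ 2)) * + m     ≡⟨ trans (cong (_* + m) (pos-^ m (p ℕ.∸ 2))) (ℤ.*-comm ((+ m) ^ (p ℕ.∸ 2)) (+ m)) ⟩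
    (+ m) ^ suc (p ℕ.∸ 2)         ≈⟨ fermat-unit p≡2+[p-2] m≉0 ⟩
    1ℤ                            ∎
    where
    open ≈-Reasoning
    p≡2+[p-2] : p ≡ suc (suc (p ℕ.∸ 2))
    p≡2+[p-2] = sym (ℕ.m+[n∸m]≡n (prime>1 p-prime))

  monic-non-root : ∀ n {f} → Monic n f → ∀ rs → AllPairs _≉_ rs → n < length rs →
    ∃ λ r → r ∈ rs × f r ≉ 0ℤ
  monic-non-root zero    f≡1     (r ∷ rs) _             _            =
    r , here refl , λ fr≈0 → 1≉0 (≈-trans (≈-reflexive (sym (f≡1 r))) fr≈0)
  monic-non-root (suc n) {f} f-monic (r ∷ rs) (r≉rs ∷ rs!) (s≤s n<|rs|) with f r ≈? 0ℤ
  ... | no  fr≉0 = r , here refl , fr≉0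
  ... | yes fr≈0 = non-root-of-quotient (monic-factor n f-monic r)
    where
    non-root-of-quotient : (Σ (ℤ → ℤ) λ q → Monic n q × (∀ x → f x - f r ≡ (x - r) * q x)) →
      ∃ λ r' → r' ∈ r ∷ rs × f r' ≉ 0ℤ
    non-root-of-quotient (q , q-monic , factor) with monic-non-root n q-monic rs rs! n<|rs|
    ... | r' , r'∈rs , qr'≉0 = r' , there r'∈rs , λ fr'≈0 →
      *-≉0 (λ r'-r≈0 → All.lookup r≉rs r'∈rs (≈-sym (-≈0⇒≈ r'-r≈0))) qr'≉0
        (≈-trans (≈-reflexive (sym (factor r'))) (≈-trans (sub-cong fr'≈0 fr≈0) (≈-reflexive refl)))

  units : List ℤ
  units = applyUpTo (λ i → + suc i) (ℕ.pred p)

  units-distinct : AllPairs _≉_ units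
  units-distinct = applyUpTo⁺₁ _ (ℕ.pred p) λ i<j j<p-1 i≈j →
    ℕ.<⇒≢ i<j (ℕ.suc-injective (residue-injective (suc<p (ℕ.<-trans i<j j<p-1)) (suc<p j<p-1) i≈j))

  ∈units⇒≉0 : ∀ {r} → r ∈ units → r ≉ 0ℤ
  ∈units⇒≉0 r∈units with ∈-applyUpTo⁻ _ r∈units
  ... | i , i<p-1 , refl = residue≉0 (s≤s z≤n) (suc<p i<p-1)

  ∃unit-non-root : ∀ n {f} → Monic n f → n < ℕ.pred p → ∃ λ g → g ≉ 0ℤ × f g ≉ 0ℤ
  ∃unit-non-root n f-monic n<p-1 with monic-non-root n f-monic units units-distinct
                                        (subst (n <_) (sym (length-applyUpTo _ (ℕ.pred p))) n<p-1)
  ... | g , g∈units , fg≉0 = g , ∈units⇒≉0 g∈units , fg≉0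

  square-roots : ∀ {x u} → x * x ≈ u * u → x ≈ u ⊎ x ≈ - u
  square-roots {x} {u} x²≈u² =
    Sum.map -≈0⇒≈ (λ x+u≈0 → -≈0⇒≈ (≈-trans (≈-reflexive (cong (λ t → x + t) (ℤ.neg-involutive u))) x+u≈0))
      (i*j≈0⇒i≈0⊎j≈0 (≈-trans (≈-reflexive (factor x u)) (≈⇒-≈0 x²≈u²)))
    where
    factor : ∀ x u → (x - u) * (x + u) ≡ x * x - u * u
    factor = solve-∀

  solutions-square : + 2 ≉ 0ℤ → ∀ {c u} → c ≉ 0ℤ → u * u ≈ c → solutions (λ x → x * x) c ≡ 2
  solutions-square 2≉0 {c} {u} c≉0 u²≈c = solutions≡length (u ∷ - u ∷ []) ((u≉-u ∷ []) ∷ [] ∷ []) roots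
    where
    u≉0 : u ≉ 0ℤ
    u≉0 u≈0 = c≉0 (≈-trans (≈-sym u²≈c) (≈-trans (*-cong u≈0 u≈0) (≈-reflexive refl)))
    u≉-u : u ≉ - u
    u≉-u u≈-u = *-≉0 2≉0 u≉0 (≈-trans (≈-reflexive (double u)) (≈⇒-≈0 u≈-u))
      where
      double : ∀ u → + 2 * u ≡ u - - u
      double = solve-∀
    neg-square : ∀ u → - u * - u ≡ u * u
    neg-square = solve-∀
    roots : ∀ {x} → x * x ≈ c ⇔ Any (x ≈_) (u ∷ - u ∷ [])
    roots {x} = mk⇔
      (λ x²≈c → Sum.[ here , there ∘ here ]′ (square-roots (≈-trans x²≈c (≈-sym u²≈c))))
      λ { (here x≈u) → ≈-trans (*-cong x≈u x≈u) u²≈c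
        ; (there (here x≈-u)) → ≈-trans (*-cong x≈-u x≈-u) (≈-trans (≈-reflexive (neg-square u)) u²≈c)
        ; (there (there ())) }

  module CubeRoots (k : ℕ) (p≡1+3k : p ≡ suc (3 ℕ.* k)) where

    k>0 : 0 < k
    k>0 = ℕ.n≢0⇒n>0 λ k≡0 →
      ℕ.<-irrefl (sym (trans p≡1+3k (cong (λ k → suc (3 ℕ.* k)) k≡0))) (prime>1 p-prime)

    private
      non-root : ∃ λ g → g ≉ 0ℤ × g ^ k - 1ℤ ≉ 0ℤ
      non-root = ∃unit-non-root k (monic-^-1 k k>0) (subst (k <_) (cong ℕ.pred (sym p≡1+3k)) k<3k)
        where
        k<3k : k < 3 ℕ.* k
        k<3k = ℕ.m<m+n k (ℕ.<-≤-trans k>0 (ℕ.m≤m+n k (k +ℕ 0)))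

      g : ℤ
      g = proj₁ non-root

    -- g exists because x^k − 1 has at most k < p − 1 roots; by Fermat ω is a primitive cube root of 1.
    ω : ℤ
    ω = g ^ k

    ω≉1 : ω ≉ 1ℤ
    ω≉1 = proj₂ (proj₂ non-root) ∘ ≈⇒-≈0

    ω³≈1 : ω * ω * ω ≈ 1ℤ
    ω³≈1 = begin
      ω * ω * ω            ≡⟨ assoc ω ⟩
      ω ^ 3                ≡⟨ ℤ.^-*-assoc g k 3 ⟩
      g ^ (k ℕ.* 3)        ≡⟨ cong (g ^_) (ℕ.*-comm k 3) ⟩
      g ^ (3 ℕ.* k)        ≈⟨ fermat-unit p≡1+3k (proj₁ (proj₂ non-root)) ⟩
      1ℤ                   ∎
      where
      open ≈-Reasoning
      assoc : ∀ w → w * w * w ≡ w * (w * (w * 1ℤ))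
      assoc = solve-∀

    ω≉0 : ω ≉ 0ℤ
    ω≉0 ω≈0 = 1≉0 (≈-trans (≈-sym ω³≈1) (≈-trans (*-cong (*-cong ω≈0 ω≈0) ω≈0) (≈-reflexive refl)))

    ω²+ω+1≈0 : ω * ω + ω + 1ℤ ≈ 0ℤ
    ω²+ω+1≈0 = [ ⊥-elim ∘ ω≉1 ∘ -≈0⇒≈ , id ]′
      (i*j≈0⇒i≈0⊎j≈0 (≈-trans (≈-reflexive (factor ω)) (≈⇒-≈0 ω³≈1)))
      where
      factor : ∀ w → (w - 1ℤ) * (w * w + w + 1ℤ) ≡ w * w * w - 1ℤ
      factor = solve-∀

    cube-*-unit : ∀ {w u} → w * w * w ≈ 1ℤ → (w * u) * (w * u) * (w * u) ≈ u * u * u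
    cube-*-unit {w} {u} w³≈1 = ≈-trans (≈-reflexive (regroup w u)) (≈-trans (*-cong w³≈1 ≈-refl) (≈-reflexive (ℤ.*-identityˡ _)))
      where
      regroup : ∀ w u → (w * u) * (w * u) * (w * u) ≡ (w * w * w) * (u * u * u)
      regroup = solve-∀

    ω⁶≈1 : (ω * ω) * (ω * ω) * (ω * ω) ≈ 1ℤ
    ω⁶≈1 = ≈-trans (≈-reflexive (regroup ω)) (*-cong ω³≈1 ω³≈1)
      where
      regroup : ∀ w → (w * w) * (w * w) * (w * w) ≡ (w * w * w) * (w * w * w)
      regroup = solve-∀

    cube-roots : ∀ {x u} → x * x * x ≈ u * u * u → x ≈ u ⊎ x ≈ ω * u ⊎ x ≈ ω * ω * u
    cube-roots {x} {u} x³≈u³ =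
      Sum.map -≈0⇒≈ (Sum.map -≈0⇒≈ -≈0⇒≈ ∘ i*j≈0⇒i≈0⊎j≈0) (i*j≈0⇒i≈0⊎j≈0 product≈0)
      where
      open ≈-Reasoning
      s = ω * ω + ω + 1ℤ
      factor : ∀ x u w → (x - u) * ((x - w * u) * (x - w * w * u))
                       ≡ (x * x * x - u * u * u) - (w * w + w + 1ℤ) * (u * x * x - w * u * u * x) - (w * w * w - 1ℤ) * (u * u * u)
      factor = solve-∀
      product≈0 : (x - u) * ((x - ω * u) * (x - ω * ω * u)) ≈ 0ℤ
      product≈0 = begin
        (x - u) * ((x - ω * u) * (x - ω * ω * u))
          ≡⟨ factor x u ω ⟩
        (x * x * x - u * u * u) - s * (u * x * x - ω * u * u * x) - (ω * ω * ω - 1ℤ) * (u * u * u)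
          ≈⟨ sub-cong (sub-cong (≈⇒-≈0 x³≈u³) (*-cong ω²+ω+1≈0 ≈-refl)) (*-cong (≈⇒-≈0 ω³≈1) ≈-refl) ⟩
        0ℤ - 0ℤ * (u * x * x - ω * u * u * x) - 0ℤ * (u * u * u)
          ≡⟨ vanish (u * x * x - ω * u * u * x) (u * u * u) ⟩
        0ℤ ∎
        where
        vanish : ∀ a b → 0ℤ - 0ℤ * a - 0ℤ * b ≡ 0ℤ
        vanish = solve-∀

    solutions-cube : ∀ {c u} → c ≉ 0ℤ → u * u * u ≈ c → solutions (λ x → x * x * x) c ≡ 3
    solutions-cube {c} {u} c≉0 u³≈c =
      solutions≡length (u ∷ ω * u ∷ ω * ω * u ∷ [])
        ((u≉ωu ∷ u≉ω²u ∷ []) ∷ (ωu≉ω²u ∷ []) ∷ [] ∷ []) roots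
      where
      u≉0 : u ≉ 0ℤ
      u≉0 u≈0 = c≉0 (≈-trans (≈-sym u³≈c) (≈-trans (*-cong (*-cong u≈0 u≈0) u≈0) (≈-reflexive refl)))
      ω-1≉0 : ω - 1ℤ ≉ 0ℤ
      ω-1≉0 = ω≉1 ∘ -≈0⇒≈
      u≉ωu : u ≉ ω * u
      u≉ωu u≈ωu = *-≉0 ω-1≉0 u≉0 (≈-trans (≈-reflexive (diff ω u)) (≈⇒-≈0 (≈-sym u≈ωu)))
        where
        diff : ∀ w u → (w - 1ℤ) * u ≡ w * u - u
        diff = solve-∀
      ωu≉ω²u : ω * u ≉ ω * ω * u
      ωu≉ω²u ωu≈ω²u = *-≉0 ω≉0 (*-≉0 ω-1≉0 u≉0) (≈-trans (≈-reflexive (diff ω u)) (≈⇒-≈0 (≈-sym ωu≈ω²u)))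
        where
        diff : ∀ w u → w * ((w - 1ℤ) * u) ≡ w * w * u - w * u
        diff = solve-∀
      u≉ω²u : u ≉ ω * ω * u
      u≉ω²u u≈ω²u = u≉ωu (≈-sym (begin
        ω * u             ≈⟨ *-cong (≈-refl {ω}) u≈ω²u ⟩
        ω * (ω * ω * u)   ≡⟨ rotate ω u ⟩
        ω * ω * ω * u     ≈⟨ *-cong ω³≈1 ≈-refl ⟩
        1ℤ * u            ≡⟨ ℤ.*-identityˡ u ⟩
        u                 ∎))
        where
        open ≈-Reasoning
        rotate : ∀ w u → w * (w * w * u) ≡ w * w * w * u
        rotate = solve-∀
      roots : ∀ {x} → x * x * x ≈ c ⇔ Any (x ≈_) (u ∷ ω * u ∷ ω * ω * u ∷ [])
      roots {x} = mk⇔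
        (λ x³≈c → Sum.[ here , Sum.[ there ∘ here , there ∘ there ∘ here ]′ ]′ (cube-roots (≈-trans x³≈c (≈-sym u³≈c))))
        λ { (here x≈u)                  → ≈-trans (cube-cong x≈u) u³≈c
          ; (there (here x≈ωu))          → ≈-trans (cube-cong x≈ωu) (≈-trans (cube-*-unit {ω} {u} ω³≈1) u³≈c)
          ; (there (there (here x≈ω²u))) → ≈-trans (cube-cong x≈ω²u) (≈-trans (cube-*-unit {ω * ω} {u} ω⁶≈1) u³≈c)
          ; (there (there (there ()))) }
        where
        cube-cong : ∀ {y z} → y ≈ z → y * y * y ≈ z * z * z
        cube-cong y≈z = *-cong (*-cong y≈z y≈z) y≈z

    3<p : 3 < p
    3<p = subst (3 <_) (sym p≡1+3k) (s≤s (ℕ.*-monoʳ-≤ 3 k>0))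

    2≉0 : + 2 ≉ 0ℤ
    2≉0 = residue≉0 (s≤s z≤n) (ℕ.<-trans (ℕ.n<1+n 2) 3<p)

    3≉0 : + 3 ≉ 0ℤ
    3≉0 = residue≉0 (s≤s z≤n) 3<p

    [2ω+1]²≈-3 : (+ 2 * ω + 1ℤ) * (+ 2 * ω + 1ℤ) ≈ - + 3
    [2ω+1]²≈-3 = begin
      (+ 2 * ω + 1ℤ) * (+ 2 * ω + 1ℤ)    ≡⟨ expand ω ⟩
      + 4 * (ω * ω + ω + 1ℤ) - + 3        ≈⟨ sub-cong (*-cong (≈-refl {+ 4}) ω²+ω+1≈0) ≈-refl ⟩
      + 4 * 0ℤ - + 3                      ≡⟨ refl ⟩
      - + 3                               ∎
      where
      open ≈-Reasoning
      expand : ∀ w → (+ 2 * w + 1ℤ) * (+ 2 * w + 1ℤ) ≡ + 4 * (w * w + w + 1ℤ) - + 3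
      expand = solve-∀

    3∣nonzero-cube-roots : ∀ c → 3 ℕ.∣ count (λ x → + x * + x * + x ≈ᵇ c) nonzero-residues
    3∣nonzero-cube-roots c with count≡0⊎witness (λ x → + x * + x * + x ≈ᵇ c) nonzero-residues
    ... | inj₁ none = subst (3 ℕ.∣_) (sym none) (3 ℕ.∣0)
    ... | inj₂ (x₀ , x₀∈nonzero , x₀³≈c) = subst (3 ℕ.∣_) count≡3 ℕ.∣-refl
      where
      x₀≉0 : + x₀ ≉ 0ℤ
      x₀≉0 with ∈-applyUpTo⁻ suc x₀∈nonzero
      ... | i , i<p-1 , refl = residue≉0 (s≤s z≤n) (suc<p i<p-1)
      c≉0 : c ≉ 0ℤ
      c≉0 c≈0 = *-≉0 (*-≉0 x₀≉0 x₀≉0) x₀≉0 (≈-trans (Equivalence.to T-≈ᵇ x₀³≈c) c≈0)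
      cube≈ᵇc : ℕ → Bool
      cube≈ᵇc x = + x * + x * + x ≈ᵇ c
      count≡3 : 3 ≡ count (λ x → + x * + x * + x ≈ᵇ c) nonzero-residues
      count≡3 = begin
        3                                                           ≡⟨ sym (solutions-cube {c} {+ x₀} c≉0 (Equivalence.to T-≈ᵇ x₀³≈c)) ⟩
        count (λ x → + x * + x * + x ≈ᵇ c) residues                ≡⟨ cong (count _) residues≡0∷nonzero ⟩
        count (λ x → + x * + x * + x ≈ᵇ c) (0 ∷ nonzero-residues)  ≡⟨ count-∷-reject {f = cube≈ᵇc} {x = 0} nonzero-residues (λ 0≈c → c≉0 (≈-sym (Equivalence.to T-≈ᵇ 0≈c))) ⟩
        count (λ x → + x * + x * + x ≈ᵇ c) nonzero-residues        ∎
        where open ≡-Reasoning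

    module Curve (b : ℕ) (b≉0 : + b ≉ 0ℤ) where

      B -4B -3B : ℤ
      B   = + b
      -4B = - (+ 4 * B)
      -3B = - (+ 3 * B)

      ψ₃ : ℤ → ℤ
      ψ₃ X = + 3 * X * (X * X * X + + 4 * B)

      two-torsion-not-order-3 : ∀ {X Y} → Y * Y ≈ X * X * X + B → Y ≈ 0ℤ →
        ¬ (X ≈ 0ℤ ⊎ X * X * X ≈ -4B)
      two-torsion-not-order-3 {X} {Y} curve Y≈0 = Sum.[ X≉0 , X³≉-4B ]′
        where
        X³+B≈0 : X * X * X + B ≈ 0ℤ
        X³+B≈0 = ≈-trans (≈-sym curve) (≈-trans (*-cong Y≈0 Y≈0) (≈-reflexive refl))
        X≉0 : X ≉ 0ℤ
        X≉0 X≈0 = b≉0 (begin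
          B                   ≡⟨ solve-B X B ⟩
          (X * X * X + B) - X * X * X  ≈⟨ sub-cong X³+B≈0 (*-cong (*-cong X≈0 X≈0) X≈0) ⟩
          0ℤ - 0ℤ * 0ℤ * 0ℤ   ≡⟨ refl ⟩
          0ℤ                  ∎)
          where
          open ≈-Reasoning
          solve-B : ∀ X B → B ≡ (X * X * X + B) - X * X * X
          solve-B = solve-∀
        X³≉-4B : X * X * X ≉ -4B
        X³≉-4B X³≈-4B = *-≉0 3≉0 b≉0 (begin
          + 3 * B                                ≡⟨ regroup (X * X * X) B ⟩
          (X * X * X + + 4 * B) - (X * X * X + B) ≈⟨ sub-cong (+-cong X³≈-4B (≈-refl {+ 4 * B})) X³+B≈0 ⟩
          (-4B + + 4 * B) - 0ℤ                   ≡⟨ cancel B ⟩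
          0ℤ                                     ∎)
          where
          open ≈-Reasoning
          regroup : ∀ C B → + 3 * B ≡ (C + + 4 * B) - (C + B)
          regroup = solve-∀
          cancel : ∀ B → (- (+ 4 * B) + + 4 * B) - 0ℤ ≡ 0ℤ
          cancel = solve-∀

      ψ₃≈0⇔ : ∀ {X} → ψ₃ X ≈ 0ℤ ⇔ (X ≈ 0ℤ ⊎ X * X * X ≈ -4B)
      ψ₃≈0⇔ {X} = mk⇔
        (λ ψ₃≈0 → Sum.map (Sum.[ ⊥-elim ∘ 3≉0 , id ]′ ∘ i*j≈0⇒i≈0⊎j≈0) X³≈-4B (i*j≈0⇒i≈0⊎j≈0 ψ₃≈0))
        Sum.[ (λ X≈0 → ≈-trans (*-cong (*-cong (≈-refl {+ 3}) X≈0) ≈-refl) (≈-reflexive (zeroˡ (X * X * X + + 4 * B))))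
            , (λ X³≈-4B → ≈-trans (*-cong (≈-refl {+ 3 * X}) (+-cong X³≈-4B ≈-refl)) (≈-reflexive (cancel X B))) ]′
        where
        zeroˡ : ∀ C → + 3 * 0ℤ * C ≡ 0ℤ
        zeroˡ = solve-∀
        cancel : ∀ X B → + 3 * X * (- (+ 4 * B) + + 4 * B) ≡ 0ℤ
        cancel = solve-∀
        X³≈-4B : X * X * X + + 4 * B ≈ 0ℤ → X * X * X ≈ -4B
        X³≈-4B X³+4B≈0 = begin
          X * X * X                             ≡⟨ shift (X * X * X) B ⟩
          (X * X * X + + 4 * B) - + 4 * B       ≈⟨ sub-cong X³+4B≈0 ≈-refl ⟩
          0ℤ - + 4 * B                          ≡⟨ ℤ.+-identityˡ _ ⟩
          -4B                                   ∎
          where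
          open ≈-Reasoning
          shift : ∀ C B → C ≡ (C + + 4 * B) - + 4 * B
          shift = solve-∀

      tangent-criterion : ∀ {X Y L} → Y ≉ 0ℤ → Y * Y ≈ X * X * X + B → L * (+ 2 * Y) ≈ + 3 * (X * X) →
        L * L ≈ + 3 * X ⇔ ψ₃ X ≈ 0ℤ
      tangent-criterion {X} {Y} {L} Y≉0 curve slope = mk⇔ ψ₃≈0 L²≈3X
        where
        open ≈-Reasoning
        ψ₃≈0 : L * L ≈ + 3 * X → ψ₃ X ≈ 0ℤ
        ψ₃≈0 L²≈3X = begin
          ψ₃ X
            ≡⟨ expand X B ⟩
          + 4 * (+ 3 * X) * (X * X * X + B) - (+ 3 * (X * X)) * (+ 3 * (X * X))
            ≈⟨ sub-cong (*-cong (*-cong (≈-refl {+ 4}) (≈-sym L²≈3X)) (≈-sym curve)) (*-cong (≈-sym slope) (≈-sym slope)) ⟩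
          + 4 * (L * L) * (Y * Y) - (L * (+ 2 * Y)) * (L * (+ 2 * Y))
            ≡⟨ vanish L Y ⟩
          0ℤ ∎
          where
          expand : ∀ X B → + 3 * X * (X * X * X + + 4 * B)
                         ≡ + 4 * (+ 3 * X) * (X * X * X + B) - (+ 3 * (X * X)) * (+ 3 * (X * X))
          expand = solve-∀
          vanish : ∀ L Y → + 4 * (L * L) * (Y * Y) - (L * (+ 2 * Y)) * (L * (+ 2 * Y)) ≡ 0ℤ
          vanish = solve-∀
        L²≈3X : ψ₃ X ≈ 0ℤ → L * L ≈ + 3 * X
        L²≈3X ψ₃≈0 = Sum.[ -≈0⇒≈ , ⊥-elim ∘ *-≉0 (*-≉0 2≉0 2≉0) (*-≉0 Y≉0 Y≉0) ]′ (i*j≈0⇒i≈0⊎j≈0 (begin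
          (L * L - + 3 * X) * (+ 4 * (Y * Y))
            ≡⟨ expand L X Y ⟩
          (L * (+ 2 * Y)) * (L * (+ 2 * Y)) - + 12 * X * (Y * Y)
            ≈⟨ sub-cong (*-cong slope slope) (*-cong (≈-refl {+ 12 * X}) curve) ⟩
          (+ 3 * (X * X)) * (+ 3 * (X * X)) - + 12 * X * (X * X * X + B)
            ≡⟨ collect X B ⟩
          - ψ₃ X
            ≈⟨ -‿cong ψ₃≈0 ⟩
          0ℤ ∎))
          where
          expand : ∀ L X Y → (L * L - + 3 * X) * (+ 4 * (Y * Y))
                           ≡ (L * (+ 2 * Y)) * (L * (+ 2 * Y)) - + 12 * X * (Y * Y)
          expand = solve-∀
          collect : ∀ X B → (+ 3 * (X * X)) * (+ 3 * (X * X)) - + 12 * X * (X * X * X + B)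
                          ≡ - (+ 3 * X * (X * X * X + + 4 * B))
          collect = solve-∀

      doubled-x≈x⇔ : ∀ {X L} → L * L - X - X ≈ X ⇔ L * L ≈ + 3 * X
      doubled-x≈x⇔ {X} {L} = mk⇔
        (λ x₂≈X → ≈-trans (≈-reflexive (shift (L * L) X)) (≈-trans (+-cong x₂≈X (≈-refl {+ 2 * X})) (≈-reflexive (triple X))))
        (λ L²≈3X → ≈-trans (sub-cong (sub-cong L²≈3X (≈-refl {X})) (≈-refl {X})) (≈-reflexive (untriple X)))
        where
        shift : ∀ S X → S ≡ (S - X - X) + + 2 * X
        shift = solve-∀
        triple : ∀ X → X + + 2 * X ≡ + 3 * X
        triple = solve-∀
        untriple : ∀ X → + 3 * X - X - X ≡ X
        untriple = solve-∀

      onCurve : ℕ × ℕ → Bool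
      onCurve (x , y) = (y ⊗ y) == ((x ⊗ (x ⊗ x)) ⊕ b)

      cube-≈ : ∀ x → + (x ⊗ (x ⊗ x)) ≈ + x * + x * + x
      cube-≈ x = ≈-trans (⊗-≈ x (x ⊗ x)) (≈-trans (*-cong (≈-refl {+ x}) (⊗-≈ x x)) (≈-reflexive (sym (ℤ.*-assoc (+ x) (+ x) (+ x)))))

      onCurve⇔ : ∀ {x y} → T (onCurve (x , y)) ⇔ + y * + y ≈ + x * + x * + x + B
      onCurve⇔ {x} {y} = ⇔.trans ==⇔≈ (≈-resp-⇔ (⊗-≈ y y) (≈-trans (⊕-≈ (x ⊗ (x ⊗ x)) b) (+-cong (cube-≈ x) ≈-refl)))

      y⊕y==0⇔ : ∀ {y} → T ((y ⊕ y) == 0) ⇔ + y ≈ 0ℤ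
      y⊕y==0⇔ {y} = ⇔.trans ==⇔≈ (⇔.trans (≈-resp-⇔ (⊕-≈ y y) ≈-refl) (mk⇔
        (λ 2y≈0 → Sum.[ ⊥-elim ∘ 2≉0 , id ]′ (i*j≈0⇒i≈0⊎j≈0 (≈-trans (≈-reflexive (double (+ y))) 2y≈0)))
        (λ y≈0 → ≈-trans (+-cong y≈0 y≈0) (≈-reflexive refl))))
        where
        double : ∀ Y → + 2 * Y ≡ Y + Y
        double = solve-∀

      isInfinity : Pt → Bool
      isInfinity nothing  = true
      isInfinity (just _) = false

      isOrder3≡ : ∀ P → isOrder3 P ≡ isInfinity (addPt (addPt (just P) (just P)) (just P))
      isOrder3≡ P with addPt (addPt (just P) (just P)) (just P)
      ... | nothing = refl
      ... | just _  = refl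

      sum-isInfinity : ∀ x₁ y₁ x₂ y₂ →
        isInfinity (addPt (just (x₁ , y₁)) (just (x₂ , y₂))) ≡ (x₁ == x₂) ∧ ((y₁ ⊕ y₂) == 0)
      sum-isInfinity x₁ y₁ x₂ y₂ with x₁ == x₂ | (y₁ ⊕ y₂) == 0
      ... | true  | true  = refl
      ... | true  | false = refl
      ... | false | _     = refl

      slope : ℕ → ℕ → ℕ
      slope x y = (3 ⊗ (x ⊗ x)) ⊗ inv (2 ⊗ y)

      double-x : ℕ → ℕ → ℕ
      double-x x y = ((slope x y ⊗ slope x y) ⊖ x) ⊖ x

      double-y : ℕ → ℕ → ℕ
      double-y x y = (slope x y ⊗ (x ⊖ double-x x y)) ⊖ y

      doubling : ∀ x y → addPt (just (x , y)) (just (x , y))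
                       ≡ (if (y ⊕ y) == 0 then nothing else just (double-x x y , double-y x y))
      doubling x y = cong (λ t → if t then doubled else chord) (Equivalence.to T-≡ (Equivalence.from ==⇔≈ (≈-refl {+ x})))
        where
        doubled = if (y ⊕ y) == 0 then nothing else just (double-x x y , double-y x y)
        chord-slope = (y ⊖ y) ⊗ inv (x ⊖ x)
        chord-x     = ((chord-slope ⊗ chord-slope) ⊖ x) ⊖ x
        chord       = just (chord-x , (chord-slope ⊗ (x ⊖ chord-x)) ⊖ y)

      isOrder3-unfold : ∀ x y → isOrder3 (x , y)
        ≡ (if (y ⊕ y) == 0 then false else (double-x x y == x) ∧ ((double-y x y ⊕ y) == 0))
      isOrder3-unfold x y = begin
        isOrder3 (x , y)
          ≡⟨ isOrder3≡ (x , y) ⟩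
        isInfinity (addPt (addPt (just (x , y)) (just (x , y))) (just (x , y)))
          ≡⟨ cong (λ Q → isInfinity (addPt Q (just (x , y)))) (doubling x y) ⟩
        isInfinity (addPt (if (y ⊕ y) == 0 then nothing else just (double-x x y , double-y x y)) (just (x , y)))
          ≡⟨ push-if ((y ⊕ y) == 0) ⟩
        (if (y ⊕ y) == 0 then false else (double-x x y == x) ∧ ((double-y x y ⊕ y) == 0)) ∎
        where
        open ≡-Reasoning
        push-if : ∀ t → isInfinity (addPt (if t then nothing else just (double-x x y , double-y x y)) (just (x , y)))
                      ≡ (if t then false else (double-x x y == x) ∧ ((double-y x y ⊕ y) == 0))
        push-if true  = refl
        push-if false = sum-isInfinity (double-x x y) (double-y x y) x y

      slope-≈ : ∀ {x y} → + y ≉ 0ℤ → + (slope x y) * (+ 2 * + y) ≈ + 3 * (+ x * + x)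
      slope-≈ {x} {y} y≉0 = begin
        + (slope x y) * (+ 2 * + y)                     ≈⟨ *-cong (⊗-≈ (3 ⊗ (x ⊗ x)) (inv (2 ⊗ y))) (≈-sym (⊗-≈ 2 y)) ⟩
        + (3 ⊗ (x ⊗ x)) * + inv (2 ⊗ y) * + (2 ⊗ y)     ≡⟨ ℤ.*-assoc (+ (3 ⊗ (x ⊗ x))) _ _ ⟩
        + (3 ⊗ (x ⊗ x)) * (+ inv (2 ⊗ y) * + (2 ⊗ y))   ≈⟨ *-cong (≈-trans (⊗-≈ 3 (x ⊗ x)) (*-cong (≈-refl {+ 3}) (⊗-≈ x x))) (inv-≈ (2 ⊗ y) 2y≉0) ⟩
        + 3 * (+ x * + x) * 1ℤ                           ≡⟨ ℤ.*-identityʳ _ ⟩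
        + 3 * (+ x * + x)                                ∎
        where
        open ≈-Reasoning
        2y≉0 : + (2 ⊗ y) ≉ 0ℤ
        2y≉0 = *-≉0 2≉0 y≉0 ∘ ≈-trans (≈-sym (⊗-≈ 2 y))

      double-x-≈ : ∀ x y → + (double-x x y) ≈ + (slope x y) * + (slope x y) - + x - + x
      double-x-≈ x y = ≈-trans (⊖-≈ _ x) (sub-cong (≈-trans (⊖-≈ _ x) (sub-cong (⊗-≈ (slope x y) (slope x y)) ≈-refl)) ≈-refl)

      double-y-≈ : ∀ x y → + (double-y x y) ≈ + (slope x y) * (+ x - + (double-x x y)) - + y
      double-y-≈ x y = ≈-trans (⊖-≈ (slope x y ⊗ (x ⊖ double-x x y)) y)
        (sub-cong (≈-trans (⊗-≈ (slope x y) (x ⊖ double-x x y)) (*-cong (≈-refl {+ slope x y}) (⊖-≈ x (double-x x y)))) (≈-refl {+ y}))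

      order-3⇔ : ∀ {x y} → T (onCurve (x , y)) →
        T (isOrder3 (x , y)) ⇔ (+ x ≈ 0ℤ ⊎ + x * + x * + x ≈ -4B)
      order-3⇔ {x} {y} on-curve =
        subst (λ t → T t ⇔ _) (sym (isOrder3-unfold x y)) (by-2-torsion ((y ⊕ y) == 0) refl)
        where
        curve = Equivalence.to (onCurve⇔ {x} {y}) on-curve
        X = + x
        L = + (slope x y)
        by-2-torsion : ∀ t → t ≡ (y ⊕ y) == 0 →
          T (if t then false else (double-x x y == x) ∧ ((double-y x y ⊕ y) == 0)) ⇔ (X ≈ 0ℤ ⊎ X * X * X ≈ -4B)
        by-2-torsion true  t≡ = mk⇔ (λ ()) (⊥-elim ∘ two-torsion-not-order-3 {X} {+ y} curve y≈0)
          where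
          y≈0 : + y ≈ 0ℤ
          y≈0 = Equivalence.to (y⊕y==0⇔ {y}) (subst T t≡ _)
        by-2-torsion false t≡ = ⇔.trans T-∧ (mk⇔
          (λ (x₂==x , _) → Equivalence.to x-criterion (Equivalence.to ==⇔≈ x₂==x))
          (λ order-3 → let x₂≈x = Equivalence.from x-criterion order-3 in
                       Equivalence.from ==⇔≈ x₂≈x , Equivalence.from ==⇔≈ (y₂+y≈0 x₂≈x)))
          where
          y≉0 : + y ≉ 0ℤ
          y≉0 y≈0 = subst T (sym t≡) (Equivalence.from (y⊕y==0⇔ {y}) y≈0)
          x-criterion : + (double-x x y) ≈ X ⇔ (X ≈ 0ℤ ⊎ X * X * X ≈ -4B)
          x-criterion = ⇔.trans (≈-resp-⇔ (double-x-≈ x y) ≈-refl) (⇔.trans (doubled-x≈x⇔ {X} {L})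
                          (⇔.trans (tangent-criterion {X} {+ y} {L} y≉0 curve (slope-≈ {x} {y} y≉0)) (ψ₃≈0⇔ {X})))
          y₂+y≈0 : + (double-x x y) ≈ X → + (double-y x y ⊕ y) ≈ + 0
          y₂+y≈0 x₂≈x = begin
            + (double-y x y ⊕ y)                  ≈⟨ ⊕-≈ (double-y x y) y ⟩
            + (double-y x y) + + y                ≈⟨ +-cong (double-y-≈ x y) ≈-refl ⟩
            L * (X - + (double-x x y)) - + y + + y ≈⟨ +-cong (sub-cong (*-cong (≈-refl {L}) (sub-cong (≈-refl {X}) x₂≈x)) ≈-refl) ≈-refl ⟩
            L * (X - X) - + y + + y               ≡⟨ cancel L X (+ y) ⟩
            + 0                                   ∎
            where
            open ≈-Reasoning
            cancel : ∀ L X Y → L * (X - X) - Y + Y ≡ 0ℤ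
            cancel = solve-∀

      points : List (ℕ × ℕ)
      points = cartesianProduct residues residues

      solutions-square-b : count (λ y → onCurve (0 , y)) residues ≡ solutions (λ y → y * y) B
      solutions-square-b = count-cong residues λ {y} _ → ⇔.trans (onCurve⇔ {0} {y}) (⇔.sym T-≈ᵇ)

      -- Points with x ≠ 0 are counted column by column: {x ≠ 0 : x³ = y² − b} is empty or {x, ωx, ω²x}.
      card-decomposition : ∃ λ r → 3 ℕ.∣ r × card b ≡ suc (solutions (λ y → y * y) B +ℕ r)
      card-decomposition = ∑[ y ∈ residues ] count (λ x → onCurve (x , y)) nonzero-residues
                         , ∣-∑ residues (λ {y} _ → 3∣column y) , cong suc (begin
        length (filterᵇ onCurve points)
          ≡⟨ length-filterᵇ onCurve points ⟩
        count onCurve points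
          ≡⟨ ∑-cartesianProduct _ residues residues ⟩
        ∑[ x ∈ residues ] count (λ y → onCurve (x , y)) residues
          ≡⟨ cong (λ xs → ∑[ x ∈ xs ] count (λ y → onCurve (x , y)) residues) residues≡0∷nonzero ⟩
        count (λ y → onCurve (0 , y)) residues +ℕ ∑[ x ∈ nonzero-residues ] count (λ y → onCurve (x , y)) residues
          ≡⟨ cong₂ _+ℕ_ solutions-square-b (∑-comm (λ x y → 𝟙 (onCurve (x , y))) nonzero-residues residues) ⟩
        solutions (λ y → y * y) B +ℕ ∑[ y ∈ residues ] count (λ x → onCurve (x , y)) nonzero-residues ∎)
        where
        open ≡-Reasoning
        3∣column : ∀ y → 3 ℕ.∣ count (λ x → onCurve (x , y)) nonzero-residues
        3∣column y = subst (3 ℕ.∣_) (sym (count-cong nonzero-residues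
          λ {x} _ → ⇔.trans (onCurve⇔ {x} {y}) (⇔.trans shift (⇔.sym T-≈ᵇ)))) (3∣nonzero-cube-roots (+ y * + y - B))
          where
          shift : ∀ {X} → + y * + y ≈ X + B ⇔ X ≈ + y * + y - B
          shift {X} = mk⇔
            (λ Y²≈X+B → ≈-trans (≈-reflexive (add-sub X B)) (≈-sym (sub-cong Y²≈X+B (≈-refl {B}))))
            (λ X≈Y²-B → ≈-trans (≈-reflexive (sub-add (+ y * + y) B)) (+-cong (≈-sym X≈Y²-B) ≈-refl))
            where
            add-sub : ∀ X B → X ≡ X + B - B
            add-sub = solve-∀
            sub-add : ∀ S B → S ≡ (S - B) + B
            sub-add = solve-∀

      -4B+B≡-3B : -4B + B ≡ -3B
      -4B+B≡-3B = regroup B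
        where
        regroup : ∀ B → - (+ 4 * B) + B ≡ - (+ 3 * B)
        regroup = solve-∀

      curve-at : ∀ {X Y c} → X * X * X ≈ c → Y * Y ≈ X * X * X + B ⇔ Y * Y ≈ c + B
      curve-at X³≈c = ≈-resp-⇔ ≈-refl (+-cong X³≈c ≈-refl)

      curve×order-3⇔ : ∀ {X Y} → (Y * Y ≈ X * X * X + B × (X ≈ 0ℤ ⊎ X * X * X ≈ -4B)) ⇔
                                 ((X ≈ 0ℤ × Y * Y ≈ B) ⊎ (X * X * X ≈ -4B × Y * Y ≈ -3B))
      curve×order-3⇔ {X} {Y} = mk⇔
        (λ { (curve , inj₁ X≈0)    → inj₁ (X≈0 , Equivalence.to (at (X³≈0 X≈0)) curve)
           ; (curve , inj₂ X³≈-4B) → inj₂ (X³≈-4B , subst (Y * Y ≈_) -4B+B≡-3B (Equivalence.to (at X³≈-4B) curve)) })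
        (λ { (inj₁ (X≈0 , Y²≈B))       → Equivalence.from (at (X³≈0 X≈0)) Y²≈B , inj₁ X≈0
           ; (inj₂ (X³≈-4B , Y²≈-3B)) → Equivalence.from (at X³≈-4B) (subst (Y * Y ≈_) (sym -4B+B≡-3B) Y²≈-3B)
                                      , inj₂ X³≈-4B })
        where
        at : ∀ {c} → X * X * X ≈ c → Y * Y ≈ X * X * X + B ⇔ Y * Y ≈ c + B
        at = curve-at {X} {Y}
        X³≈0 : X ≈ 0ℤ → X * X * X ≈ 0ℤ
        X³≈0 X≈0 = ≈-trans (*-cong (*-cong X≈0 X≈0) X≈0) (≈-reflexive refl)

      at-x≈0 at-x³≈-4B : ℕ × ℕ → Bool
      at-x≈0    (x , y) = (+ x ≈ᵇ 0ℤ) ∧ (+ y * + y ≈ᵇ B)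
      at-x³≈-4B (x , y) = (+ x * + x * + x ≈ᵇ -4B) ∧ (+ y * + y ≈ᵇ -3B)

      order-3-point⇔ : ∀ P → T (onCurve P ∧ isOrder3 P) ⇔ T (at-x≈0 P ∨ at-x³≈-4B P)
      order-3-point⇔ (x , y) = ⇔.trans (⇔.trans T-∧ on-curve×order-3) (⇔.trans (curve×order-3⇔ {+ x} {+ y}) (⇔.sym at⇔))
        where
        on-curve×order-3 : (T (onCurve (x , y)) × T (isOrder3 (x , y))) ⇔
                           (+ y * + y ≈ + x * + x * + x + B × (+ x ≈ 0ℤ ⊎ + x * + x * + x ≈ -4B))
        on-curve×order-3 = mk⇔
          (λ (on , order-3) → Equivalence.to (onCurve⇔ {x} {y}) on , Equivalence.to (order-3⇔ on) order-3)
          (λ (curve , order-3) → let on = Equivalence.from (onCurve⇔ {x} {y}) curve in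
                                 on , Equivalence.from (order-3⇔ on) order-3)
        at⇔ : T (at-x≈0 (x , y) ∨ at-x³≈-4B (x , y)) ⇔
              ((+ x ≈ 0ℤ × + y * + y ≈ B) ⊎ (+ x * + x * + x ≈ -4B × + y * + y ≈ -3B))
        at⇔ = ⇔.trans T-∨ (⇔.trans T-∧ (T-≈ᵇ ×-⇔ T-≈ᵇ) ⊎-⇔ ⇔.trans T-∧ (T-≈ᵇ ×-⇔ T-≈ᵇ))

      x≈0⇒x³≉-4B : ∀ {X} → X ≈ 0ℤ → X * X * X ≉ -4B
      x≈0⇒x³≉-4B {X} X≈0 X³≈-4B = *-≉0 (*-≉0 2≉0 2≉0) b≉0 (begin
        + 4 * B             ≡⟨ negate-twice B ⟩
        - -4B               ≈⟨ -‿cong (≈-sym X³≈-4B) ⟩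
        - (X * X * X)       ≈⟨ -‿cong (*-cong (*-cong X≈0 X≈0) X≈0) ⟩
        - (0ℤ * 0ℤ * 0ℤ)    ≡⟨ refl ⟩
        0ℤ                  ∎)
        where
        open ≈-Reasoning
        negate-twice : ∀ B → + 4 * B ≡ - (- (+ 4 * B))
        negate-twice = solve-∀

      numOrder3≡ : numOrder3 b ≡ solutions (λ y → y * y) B +ℕ
                                 solutions (λ x → x * x * x) -4B ℕ.* solutions (λ y → y * y) -3B
      numOrder3≡ = begin
        length (filterᵇ isOrder3 (filterᵇ onCurve points))
          ≡⟨ length-filterᵇ isOrder3 (filterᵇ onCurve points) ⟩
        count isOrder3 (filterᵇ onCurve points)
          ≡⟨ count-filterᵇ onCurve isOrder3 points ⟩
        count (λ P → onCurve P ∧ isOrder3 P) points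
          ≡⟨ count-cong points (λ {P} _ → order-3-point⇔ P) ⟩
        count (λ P → at-x≈0 P ∨ at-x³≈-4B P) points
          ≡⟨ count-∨ points disjoint ⟩
        count at-x≈0 points +ℕ count at-x³≈-4B points
          ≡⟨ cong₂ _+ℕ_ (count-× (λ x → + x ≈ᵇ 0ℤ) _ residues residues) (count-× _ _ residues residues) ⟩
        count (λ x → + x ≈ᵇ 0ℤ) residues ℕ.* Sq B +ℕ Cb -4B ℕ.* Sq -3B
          ≡⟨ cong (λ n → n ℕ.* Sq B +ℕ Cb -4B ℕ.* Sq -3B) (count-residues≈ 0ℤ) ⟩
        1 ℕ.* Sq B +ℕ Cb -4B ℕ.* Sq -3B
          ≡⟨ cong (_+ℕ Cb -4B ℕ.* Sq -3B) (ℕ.*-identityˡ (Sq B)) ⟩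
        Sq B +ℕ Cb -4B ℕ.* Sq -3B ∎
        where
        open ≡-Reasoning
        Sq = solutions (λ y → y * y)
        Cb = solutions (λ x → x * x * x)
        disjoint : ∀ {P} → P ∈ points → T (at-x≈0 P) → ¬ T (at-x³≈-4B P)
        disjoint {x , y} _ at₀ at₁ =
          x≈0⇒x³≉-4B (Equivalence.to T-≈ᵇ (proj₁ (Equivalence.to T-∧ at₀)))
                     (Equivalence.to T-≈ᵇ (proj₁ (Equivalence.to T-∧ at₁)))

      b-is-square : 3 ℕ.∣ card b → solutions (λ y → y * y) B ≢ 0
      b-is-square 3∣card #√B≡0 = 3≢1 (ℕ.∣1⇒≡1 (ℕ.∣m+n∣m⇒∣n 3∣r+1 3∣r))
        where
        r = proj₁ card-decomposition
        3∣r = proj₁ (proj₂ card-decomposition)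
        3≢1 : 3 ≢ 1
        3≢1 ()
        3∣r+1 : 3 ℕ.∣ r +ℕ 1
        3∣r+1 = subst (3 ℕ.∣_) (trans (proj₂ (proj₂ card-decomposition))
                                       (trans (cong (λ n → suc (n +ℕ r)) #√B≡0) (ℕ.+-comm 1 r))) 3∣card

      -3B-square : ∀ {u} → u * u ≈ B → (+ 2 * ω + 1ℤ) * u * ((+ 2 * ω + 1ℤ) * u) ≈ -3B
      -3B-square {u} u²≈B = begin
        (+ 2 * ω + 1ℤ) * u * ((+ 2 * ω + 1ℤ) * u)    ≡⟨ regroup (+ 2 * ω + 1ℤ) u ⟩
        (+ 2 * ω + 1ℤ) * (+ 2 * ω + 1ℤ) * (u * u)    ≈⟨ *-cong [2ω+1]²≈-3 u²≈B ⟩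
        - + 3 * B                                    ≡⟨ sym (ℤ.neg-distribˡ-* (+ 3) B) ⟩
        -3B                                          ∎
        where
        open ≈-Reasoning
        regroup : ∀ s u → s * u * (s * u) ≡ s * s * (u * u)
        regroup = solve-∀

      numOrder3-if-square : ∀ {u} → u * u ≈ B → numOrder3 b ≡ 2 +ℕ solutions (λ x → x * x * x) -4B ℕ.* 2
      numOrder3-if-square {u} u²≈B = trans numOrder3≡ (cong₂ (λ s t → s +ℕ solutions (λ x → x * x * x) -4B ℕ.* t)
        (solutions-square 2≉0 {B} {u} b≉0 u²≈B)
        (solutions-square 2≉0 {c = -3B} {u = (+ 2 * ω + 1ℤ) * u} (-‿≉0 (*-≉0 3≉0 b≉0)) (-3B-square u²≈B)))

      #cube-roots-of-4B : solutions (λ x → x * x * x) -4B ≡ 0 ⊎ solutions (λ x → x * x * x) -4B ≡ 3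
      #cube-roots-of-4B with count≡0⊎witness (λ x → + x * + x * + x ≈ᵇ -4B) residues
      ... | inj₁ none                = inj₁ none
      ... | inj₂ (x₀ , _ , x₀³≈-4B) =
        inj₂ (solutions-cube {c = -4B} {u = + x₀} (-‿≉0 (*-≉0 (*-≉0 2≉0 2≉0) b≉0)) (Equivalence.to T-≈ᵇ x₀³≈-4B))

      numOrder3≡2⊎8 : 3 ℕ.∣ card b → numOrder3 b ≡ 2 ⊎ numOrder3 b ≡ 8
      numOrder3≡2⊎8 3∣card with count≡0⊎witness (λ y → + y * + y ≈ᵇ B) residues
      ... | inj₁ #√B≡0            = ⊥-elim (b-is-square 3∣card #√B≡0)
      ... | inj₂ (y₀ , _ , y₀²≈B) = Sum.map (λ #∛≡0 → trans order (cong (λ n → 2 +ℕ n ℕ.* 2) #∛≡0))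
                                             (λ #∛≡3 → trans order (cong (λ n → 2 +ℕ n ℕ.* 2) #∛≡3))
                                             #cube-roots-of-4B
        where
        order = numOrder3-if-square {u = + y₀} (Equivalence.to T-≈ᵇ y₀²≈B)

open import Data.Nat using (ℕ; _^_; _≤_; _<_; NonZero)
open import Data.Nat.DivMod using (_%_)
open import Data.Nat.Primality using (Prime)
open import Data.Sum using (_⊎_)
open import Relation.Binary.PropositionalEquality using (_≡_)

open import Data.Integer using (+_; 0ℤ)
import Data.Nat as ℕ
open import Data.Nat.DivMod using (_/_; m≡m%n+[m/n]*n)
open import Data.Nat.Divisibility using (_∣_; ∣-trans; divides-refl; m%n≡0⇒n∣m)
import Data.Nat.Tactic.RingSolver as ℕ-Solver
open import Relation.Binary.PropositionalEquality using (trans; cong; sym; subst)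

p%6≡1⇒p≡1+3k : ∀ p → p % 6 ≡ 1 → p ≡ ℕ.suc (3 ℕ.* (2 ℕ.* (p / 6)))
p%6≡1⇒p≡1+3k p p%6≡1 = trans (m≡m%n+[m/n]*n p 6) (trans (cong (ℕ._+ (p / 6) ℕ.* 6) p%6≡1) (regroup (p / 6)))
  where
  regroup : ∀ q → 1 ℕ.+ q ℕ.* 6 ≡ ℕ.suc (3 ℕ.* (2 ℕ.* q))
  regroup = ℕ-Solver.solve-∀

theorem9 : (p : ℕ) .{{_ : NonZero p}} → Prime p → p % 6 ≡ 1 →
    (a : ℕ) → 1 ≤ a → a < p →
    Fp.card p (a ^ 3) % 6 ≡ 0 →
    Fp.numOrder3 p (a ^ 3) ≡ 2 ⊎ Fp.numOrder3 p (a ^ 3) ≡ 8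
theorem9 p p-prime p%6≡1 a 1≤a a<p card%6≡0 = Curve.numOrder3≡2⊎8 (a ^ 3) a³≉0 3∣card
  where
  open IntegersModPrime p p-prime
  open CubeRoots (2 ℕ.* (p / 6)) (p%6≡1⇒p≡1+3k p p%6≡1)
  a≉0 : + a ≉ 0ℤ
  a≉0 = residue≉0 1≤a a<p
  a³≉0 : + (a ^ 3) ≉ 0ℤ
  a³≉0 = subst (_≉ 0ℤ) (sym (pos-^ a 3)) (*-≉0 a≉0 (*-≉0 a≉0 (*-≉0 a≉0 1≉0)))
  3∣card : 3 ∣ Fp.card p (a ^ 3)
  3∣card = ∣-trans (divides-refl 2) (m%n≡0⇒n∣m (Fp.card p (a ^ 3)) 6 card%6≡0)
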